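{- Let $p$ be a prime and let $V,W$ be finite-dimensional $\mathbb{F}_p$-vector spaces with bases $v_1,\ldots,v_d$ and $w_1,\ldots,w_e$ respectively. Let $(\cdot,\cdot)$ be a skew-symmetric bilinear form on $V\oplus W$ with values in $\mathbb{F}_p$ whose restriction to $V$ is non-degenerate, whose restriction to $W$ is trivial, and such that $(v,w)=0$ for all $v\in V$, $w\in W$. Let $N$ be the number of triples $(x,y,z)\in (V\oplus W)^3$ with $(x,y)=(y,z)=0$ and $x,y,z$ $\mathbb{F}_p$-linearly independent. (1) If $(v_i,v_i)=0$ for all $1\leq i\leq d$, then \[N=(p^d-1)p^e(p^{d+e-1}-p)(p^{d+e-1}-p^2)+(p^e-1)(p^{d+e}-p)(p^{d+e}-p^2).\] (2) If $(v_1,v_1)=1$ and $(v_i,v_i)=0$ for all $2\leq i\leq d$, then $p=2$ and \[N=(2^{d+e-1}-2)(2^{2d+2e-1}+3\cdot 2^{d+2e-1}-9\cdot2^{d+e-1}+4).\]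
   Context: A bilinear form is skew-symmetric if $(x,y)=-(y,x)$ for all $x,y$. -}

module Defs where

open import Data.Nat using (ℕ; zero; suc; _+_; _*_; _∸_; NonZero)
open import Data.Nat.DivMod using (_mod_)
open import Data.Nat.Primality using (Prime; prime⇒nonZero)
open import Data.Fin using (Fin; toℕ; _≟_)
import Data.Fin.Properties as FinP
open import Data.Vec using (Vec; []; _∷_; _++_; replicate; zipWith; map)
import Data.Vec.Properties as VecP
open import Data.List using (List; [_]; concatMap; filter; length; cartesianProduct; allFin)
import Data.List as L
open import Data.Product using (_×_; _,_)
open import Relation.Binary.PropositionalEquality using (_≡_)
open import Relation.Nullary using (Dec; _×-dec_; _→-dec_)
open import Relation.Unary using (Decidable)

module Fp (p : ℕ) (pr : Prime p) where
  instance
    p≢0 : NonZero p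
    p≢0 = prime⇒nonZero pr

  F : Set
  F = Fin p

  0F : F
  0F = 0 mod p

  1F : F
  1F = 1 mod p

  _+F_ : F → F → F
  a +F b = (toℕ a + toℕ b) mod p

  _*F_ : F → F → F
  a *F b = (toℕ a * toℕ b) mod p

  -F_ : F → F
  -F a = (p ∸ toℕ a) mod p

  Vect : ℕ → Set
  Vect n = Vec F n

  0V : ∀ {n} → Vect n
  0V = replicate _ 0F

  _+V_ : ∀ {n} → Vect n → Vect n → Vect n
  _+V_ = zipWith _+F_

  _·V_ : ∀ {n} → F → Vect n → Vect n
  c ·V x = map (c *F_) x

  unit : ∀ {n} → Fin n → Vect n
  unit {suc n} Fin.zero    = 1F ∷ 0V
  unit {suc n} (Fin.suc i) = 0F ∷ unit i

  inV : ∀ {d} e → Vect d → Vect (d + e)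
  inV e x = x ++ 0V

  inW : ∀ d {e} → Vect e → Vect (d + e)
  inW d y = 0V {d} ++ y

  record IsBilinear {n : ℕ} (B : Vect n → Vect n → F) : Set where
    field
      +-left  : ∀ x y z → B (x +V y) z ≡ B x z +F B y z
      ·-left  : ∀ c x z → B (c ·V x) z ≡ c *F B x z
      +-right : ∀ x y z → B x (y +V z) ≡ B x y +F B x z
      ·-right : ∀ c x z → B x (c ·V z) ≡ c *F B x z

  IsSkewSymmetric : ∀ {n} → (Vect n → Vect n → F) → Set
  IsSkewSymmetric B = ∀ x y → B x y ≡ -F (B y x)

  LinIndep3 : ∀ {n} → Vect n → Vect n → Vect n → Set
  LinIndep3 x y z = ∀ a b c → (a ·V x) +V ((b ·V y) +V (c ·V z)) ≡ 0V →
                    (a ≡ 0F) × (b ≡ 0F) × (c ≡ 0F)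

  allVecs : (n : ℕ) → List (Vect n)
  allVecs zero    = [ [] ]
  allVecs (suc n) = concatMap (λ a → L.map (a ∷_) (allVecs n)) (allFin p)

  allTriples : (n : ℕ) → List (Vect n × Vect n × Vect n)
  allTriples n = cartesianProduct (allVecs n) (cartesianProduct (allVecs n) (allVecs n))

  Good : ∀ {n} → (Vect n → Vect n → F) → Vect n × Vect n × Vect n → Set
  Good B (x , y , z) = (B x y ≡ 0F) × (B y z ≡ 0F) × LinIndep3 x y z

  private
    _≟V_ : ∀ {n} (x y : Vect n) → Dec (x ≡ y)
    _≟V_ = VecP.≡-dec _≟_

  good? : ∀ {n} (B : Vect n → Vect n → F) → Decidable (Good B)
  good? B (x , y , z) =
    (B x y ≟ 0F) ×-dec (B y z ≟ 0F) ×-dec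
    FinP.all? (λ a → FinP.all? (λ b → FinP.all? (λ c →
      (((a ·V x) +V ((b ·V y) +V (c ·V z))) ≟V 0V) →-dec
      ((a ≟ 0F) ×-dec (b ≟ 0F) ×-dec (c ≟ 0F)))))

  countN : ∀ {n} → (Vect n → Vect n → F) → ℕ
  countN {n} B = length (filter (good? B) (allTriples n))

module Submission where

-- Write n = d + e and N = Σ_y T(y), where T(y) counts the pairs (x, z) making
-- (x, y, z) a good triple.  For y ≠ 0 a triple is good exactly when
--   x ∈ y^⊥ with x ∉ ⟨y⟩,   and   z ∈ y^⊥ with z ∉ ⟨x, y⟩.
-- Let h = |y^⊥|, which is p^n if y lies in the radical of the form and p^(n-1)
-- otherwise (y^⊥ is then a hyperplane).  If (y, y) = 0 the plane ⟨x, y⟩ lies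
-- in y^⊥, so T(y) = (h - p)(h - p²); if (y, y) ≠ 0 then y^⊥ ∩ ⟨y⟩ = 0 and
-- y^⊥ ∩ ⟨x, y⟩ = ⟨x⟩, so T(y) = (h - 1)(h - p).  Writing y = a + b with
-- a ∈ V, b ∈ W, the hypotheses give (a + b, a' + b') = (a, a'); so y is
-- radical iff a = 0 (non-degeneracy on V) and (y, y) = Q(a) := (a, a).
-- Summing over (a, b) gives N as a combination of the three values of T with
-- coefficients p^e - 1, p^e·#{a ≠ 0 : Q a = 0} and p^e·#{a : Q a ≠ 0}.
-- Q is additive with Q(c a) = c² Q(a); in case (1) it vanishes identically,
-- in case (2) Q(a) = a₁², and skew-symmetry (v₁, v₁) = -(v₁, v₁) forces p = 2.

open import Defs
open import Data.Nat as ℕ using (ℕ; zero; suc; _+_; _*_; _∸_; _^_; NonZero; _<_)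
import Data.Nat.Properties as NP
open import Data.Nat.DivMod using (_mod_; _%_; m%n<n; m<n⇒m%n≡m; %-distribˡ-+; %-distribˡ-*; n%n≡0)
open import Data.Nat.Divisibility using (m%n≡0⇒n∣m; n∣m⇒m%n≡0)
open import Data.Nat.Primality using (Prime; euclidsLemma; prime⇒nonTrivial)
open import Data.Nat.Coprimality using (coprime-Bézout; prime⇒coprime)
open import Data.Nat.GCD using (module Bézout)
open import Data.Integer using (ℤ; +_) renaming (_+_ to _+ℤ_; _-_ to _-ℤ_; _*_ to _*ℤ_)
import Data.Integer.Properties as ZP
open import Data.Integer.Tactic.RingSolver using (solve-∀)
open import Data.Fin as Fin using (Fin; toℕ; _≟_)
import Data.Fin.Properties as FinP
open import Data.Vec using ([]; _∷_; _++_; splitAt)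
import Data.Vec.Properties as VecP
open import Data.List using (List; map; concat; concatMap; length; filter; cartesianProduct; allFin; tabulate)
  renaming (_++_ to _++L_)
open import Data.List.Relation.Unary.All using (All)
open import Data.Product using (_×_; _,_; Σ; ∃; proj₁; proj₂)
open import Data.Sum using (_⊎_; inj₁; inj₂)
open import Data.Empty using (⊥-elim)
open import Relation.Nullary using (¬_; Dec; yes; no; _×-dec_; ¬?)
open import Relation.Unary using (Decidable)
open import Relation.Binary.Definitions using (DecidableEquality)
open import Relation.Binary.PropositionalEquality
  using (_≡_; _≢_; refl; sym; trans; cong; cong₂; subst; module ≡-Reasoning)

sumL : ∀ {a} {A : Set a} → List A → (A → ℕ) → ℕ
sumL List.[] f = 0
sumL (x List.∷ xs) f = f x + sumL xs f

ind : ∀ {p} {P : Set p} → Dec P → ℕ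
ind (yes _) = 1
ind (no _) = 0

module _ {p q} {P : Set p} {Q : Set q} where

  ind-cong : (P → Q) → (Q → P) → (p? : Dec P) (q? : Dec Q) → ind p? ≡ ind q?
  ind-cong f g (yes a) (yes b) = refl
  ind-cong f g (yes a) (no nb) = ⊥-elim (nb (f a))
  ind-cong f g (no na) (yes b) = ⊥-elim (na (g b))
  ind-cong f g (no na) (no nb) = refl

module _ {p} {P : Set p} where

  ind-yes : P → (p? : Dec P) → ind p? ≡ 1
  ind-yes a (yes _) = refl
  ind-yes a (no na) = ⊥-elim (na a)

  ind-no : ¬ P → (p? : Dec P) → ind p? ≡ 0
  ind-no na (yes a) = ⊥-elim (na a)
  ind-no na (no _) = refl

  ind-not : (p? : Dec P) → ind (¬? p?) + ind p? ≡ 1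
  ind-not (yes _) = refl
  ind-not (no _) = refl

  fromInd : (p? : Dec P) → ind p? ≡ 1 → P
  fromInd (yes a) _ = a
  fromInd (no _) ()

module _ {p q} {P : Set p} {Q : Set q} where

  ind-× : (p? : Dec P) (q? : Dec Q) (pq? : Dec (P × Q)) → ind pq? ≡ ind p? * ind q?
  ind-× (yes a) (yes b) pq? = ind-yes (a , b) pq?
  ind-× (yes a) (no nb) pq? = ind-no (λ z → nb (proj₂ z)) pq?
  ind-× (no na) q? pq? = ind-no (λ z → na (proj₁ z)) pq?

  ind-split : (p? : Dec P) (q? : Dec Q) (pq? : Dec (P × Q)) (pnq? : Dec (P × ¬ Q)) →
              ind pq? + ind pnq? ≡ ind p?
  ind-split (yes a) (yes b) pq? pnq? = cong₂ _+_ (ind-yes (a , b) pq?) (ind-no (λ z → proj₂ z b) pnq?)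
  ind-split (yes a) (no nb) pq? pnq? = cong₂ _+_ (ind-no (λ z → nb (proj₂ z)) pq?) (ind-yes (a , nb) pnq?)
  ind-split (no na) q? pq? pnq? = cong₂ _+_ (ind-no (λ z → na (proj₁ z)) pq?) (ind-no (λ z → na (proj₁ z)) pnq?)

module _ {a} {A : Set a} where

  length-filter : ∀ {p} {P : A → Set p} (P? : Decidable P) (L : List A) →
                  length (filter P? L) ≡ sumL L (λ x → ind (P? x))
  length-filter P? List.[] = refl
  length-filter P? (x List.∷ L) with P? x
  ... | yes _ = cong suc (length-filter P? L)
  ... | no _ = length-filter P? L

  sumL-cong : ∀ (L : List A) {f g : A → ℕ} → (∀ x → f x ≡ g x) → sumL L f ≡ sumL L g
  sumL-cong List.[] eq = refl
  sumL-cong (x List.∷ L) eq = cong₂ _+_ (eq x) (sumL-cong L eq)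

  sumL-+ : ∀ (L : List A) (f g : A → ℕ) → sumL L (λ x → f x + g x) ≡ sumL L f + sumL L g
  sumL-+ List.[] f g = refl
  sumL-+ (x List.∷ L) f g = begin
      f x + g x + sumL L (λ x → f x + g x) ≡⟨ cong (λ k → f x + g x + k) (sumL-+ L f g) ⟩
      f x + g x + (sumL L f + sumL L g)   ≡⟨ NP.+-assoc (f x) (g x) _ ⟩
      f x + (g x + (sumL L f + sumL L g)) ≡⟨ cong (λ k → f x + k) (NP.+-comm (g x) _) ⟩
      f x + ((sumL L f + sumL L g) + g x) ≡⟨ cong (λ k → f x + k) (NP.+-assoc (sumL L f) _ _) ⟩
      f x + (sumL L f + (sumL L g + g x)) ≡⟨ cong (λ k → f x + (sumL L f + k)) (NP.+-comm _ (g x)) ⟩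
      f x + (sumL L f + (g x + sumL L g)) ≡⟨ sym (NP.+-assoc (f x) _ _) ⟩
      f x + sumL L f + (g x + sumL L g)   ∎
    where open ≡-Reasoning

  sumL-*ˡ : ∀ (L : List A) (c : ℕ) (f : A → ℕ) → sumL L (λ x → c * f x) ≡ c * sumL L f
  sumL-*ˡ List.[] c f = sym (NP.*-zeroʳ c)
  sumL-*ˡ (x List.∷ L) c f = trans (cong (λ k → c * f x + k) (sumL-*ˡ L c f)) (sym (NP.*-distribˡ-+ c (f x) _))

  sumL-*ʳ : ∀ (L : List A) (c : ℕ) (f : A → ℕ) → sumL L (λ x → f x * c) ≡ sumL L f * c
  sumL-*ʳ L c f = trans (sumL-cong L (λ x → NP.*-comm (f x) c)) (trans (sumL-*ˡ L c f) (NP.*-comm c _))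

  sumL-const : ∀ (L : List A) (c : ℕ) → sumL L (λ _ → c) ≡ sumL L (λ _ → 1) * c
  sumL-const L c = trans (sumL-cong L (λ _ → sym (NP.*-identityˡ c))) (sumL-*ʳ L c (λ _ → 1))

  sumL-0 : ∀ (L : List A) {f : A → ℕ} → (∀ x → f x ≡ 0) → sumL L f ≡ 0
  sumL-0 List.[] eq = refl
  sumL-0 (x List.∷ L) eq = cong₂ _+_ (eq x) (sumL-0 L eq)

  sumL-++ : ∀ (L M : List A) (f : A → ℕ) → sumL (L ++L M) f ≡ sumL L f + sumL M f
  sumL-++ List.[] M f = refl
  sumL-++ (x List.∷ L) M f = trans (cong (λ k → f x + k) (sumL-++ L M f)) (sym (NP.+-assoc (f x) _ _))

  sumL-concat : ∀ (Ls : List (List A)) (f : A → ℕ) → sumL (concat Ls) f ≡ sumL Ls (λ L → sumL L f)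
  sumL-concat List.[] f = refl
  sumL-concat (L List.∷ Ls) f = trans (sumL-++ L (concat Ls) f) (cong (λ k → sumL L f + k) (sumL-concat Ls f))

sumL-map : ∀ {a b} {A : Set a} {B : Set b} (g : A → B) (L : List A) (f : B → ℕ) →
           sumL (map g L) f ≡ sumL L (λ x → f (g x))
sumL-map g List.[] f = refl
sumL-map g (x List.∷ L) f = cong (λ k → f (g x) + k) (sumL-map g L f)

module _ {a b} {A : Set a} {B : Set b} where

  sumL-concatMap : ∀ (g : A → List B) (L : List A) (f : B → ℕ) →
                   sumL (concatMap g L) f ≡ sumL L (λ x → sumL (g x) f)
  sumL-concatMap g L f = trans (sumL-concat (map g L) f) (sumL-map g L (λ M → sumL M f))

  sumL-cart : ∀ (xs : List A) (ys : List B) (f : A × B → ℕ) →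
              sumL (cartesianProduct xs ys) f ≡ sumL xs (λ x → sumL ys (λ y → f (x , y)))
  sumL-cart List.[] ys f = refl
  sumL-cart (x List.∷ xs) ys f = trans (sumL-++ (map (x ,_) ys) _ f)
     (cong₂ _+_ (sumL-map (x ,_) ys f) (sumL-cart xs ys f))

  sumL-swap : ∀ (xs : List A) (ys : List B) (f : A → B → ℕ) →
              sumL xs (λ x → sumL ys (λ y → f x y)) ≡ sumL ys (λ y → sumL xs (λ x → f x y))
  sumL-swap List.[] ys f = sym (sumL-0 ys (λ _ → refl))
  sumL-swap (x List.∷ xs) ys f = trans (cong (λ k → sumL ys (f x) + k) (sumL-swap xs ys f)) (sym (sumL-+ ys (f x) _))

module Enumeration {A : Set} (_≟A_ : DecidableEquality A) (L : List A)
                   (enum : ∀ a → sumL L (λ x → ind (x ≟A a)) ≡ 1) where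

  pick : ∀ (f : A → ℕ) a → sumL L (λ x → ind (a ≟A x) * f x) ≡ f a
  pick f a = begin
      sumL L (λ x → ind (a ≟A x) * f x) ≡⟨ sumL-cong L at-a ⟩
      sumL L (λ x → ind (x ≟A a) * f a) ≡⟨ sumL-*ʳ L (f a) _ ⟩
      sumL L (λ x → ind (x ≟A a)) * f a ≡⟨ cong (_* f a) (enum a) ⟩
      1 * f a                           ≡⟨ NP.*-identityˡ (f a) ⟩
      f a                               ∎
    where
      open ≡-Reasoning
      at-a : ∀ x → ind (a ≟A x) * f x ≡ ind (x ≟A a) * f a
      at-a x with a ≟A x | x ≟A a
      ... | yes refl | yes _ = refl
      ... | yes refl | no x≢a = ⊥-elim (x≢a refl)
      ... | no a≢x | yes refl = ⊥-elim (a≢x refl)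
      ... | no _ | no _ = refl

  reindex : (h k : A → A) → (∀ x → k (h x) ≡ x) → (∀ y → h (k y) ≡ y) →
            ∀ (f : A → ℕ) → sumL L (λ x → f (h x)) ≡ sumL L f
  reindex h k kh hk f = begin
      sumL L (λ x → f (h x))                            ≡⟨ sumL-cong L (λ x → sym (pick f (h x))) ⟩
      sumL L (λ x → sumL L (λ y → ind (h x ≟A y) * f y)) ≡⟨ sumL-swap L L _ ⟩
      sumL L (λ y → sumL L (λ x → ind (h x ≟A y) * f y)) ≡⟨ sumL-cong L (λ y → sumL-*ʳ L (f y) _) ⟩
      sumL L (λ y → sumL L (λ x → ind (h x ≟A y)) * f y) ≡⟨ sumL-cong L (λ y → cong (_* f y) (preimage y)) ⟩
      sumL L (λ y → 1 * f y)                            ≡⟨ sumL-cong L (λ y → NP.*-identityˡ (f y)) ⟩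
      sumL L f                                          ∎
    where
      open ≡-Reasoning
      preimage : ∀ y → sumL L (λ x → ind (h x ≟A y)) ≡ 1
      preimage y = trans (sumL-cong L (λ x → ind-cong (λ e → trans (sym (kh x)) (cong k e))
                                                     (λ e → trans (cong h e) (hk y)) (h x ≟A y) (x ≟A k y)))
                         (enum (k y))

  unique : ∀ {p} {P : A → Set p} (P? : Decidable P) → (∀ a b → P a → P b → a ≡ b) →
           (E? : Dec (∃ P)) → ind E? ≡ sumL L (λ x → ind (P? x))
  unique P? uniq (yes (a , pa)) = sym (trans
      (sumL-cong L (λ x → ind-cong (λ px → uniq x a px pa) (λ e → subst _ (sym e) pa) (P? x) (x ≟A a)))
      (enum a))
  unique P? uniq (no ne) = sym (sumL-0 L (λ x → ind-no (λ px → ne (x , px)) (P? x)))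

  count-others : ∀ a → sumL L (λ x → ind (¬? (x ≟A a))) + 1 ≡ sumL L (λ _ → 1)
  count-others a = begin
      sumL L (λ x → ind (¬? (x ≟A a))) + 1                       ≡⟨ cong (λ k → sumL L (λ x → ind (¬? (x ≟A a))) + k) (sym (enum a)) ⟩
      sumL L (λ x → ind (¬? (x ≟A a))) + sumL L (λ x → ind (x ≟A a)) ≡⟨ sym (sumL-+ L _ _) ⟩
      sumL L (λ x → ind (¬? (x ≟A a)) + ind (x ≟A a))           ≡⟨ sumL-cong L (λ x → ind-not (x ≟A a)) ⟩
      sumL L (λ _ → 1)                                          ∎
    where open ≡-Reasoning

  private
    all-along : ∀ {p} {P : A → Set p} (P? : Decidable P) (M : List A) → All P M ⊎ ∃ (λ x → ¬ P x)
    all-along P? List.[] = inj₁ All.[]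
    all-along P? (x List.∷ M) with P? x | all-along P? M
    ... | no npx | _ = inj₂ (x , npx)
    ... | yes px | inj₁ pm = inj₁ (px All.∷ pm)
    ... | yes px | inj₂ w = inj₂ w

    listed : ∀ {p} {P : A → Set p} (M : List A) → All P M → ∀ a → sumL M (λ x → ind (x ≟A a)) ≢ 0 → P a
    listed List.[] All.[] a ne = ⊥-elim (ne refl)
    listed (x List.∷ M) (px All.∷ pm) a ne with x ≟A a
    ... | yes refl = px
    ... | no _ = listed M pm a ne

  ∀-or-∃¬ : ∀ {p} {P : A → Set p} (P? : Decidable P) → (∀ x → P x) ⊎ ∃ (λ x → ¬ P x)
  ∀-or-∃¬ P? with all-along P? L
  ... | inj₂ w = inj₂ w
  ... | inj₁ allL = inj₁ (λ a → listed L allL a (λ e → NP.1+n≢0 (trans (sym (enum a)) e)))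

-- Integer-valued sums, used once the three kinds of y are combined: the
-- closed formulas involve subtraction.
sumZ : ∀ {A : Set} → List A → (A → ℤ) → ℤ
sumZ List.[] f = + 0
sumZ (x List.∷ xs) f = f x +ℤ sumZ xs f

sumZ-cong : ∀ {A : Set} (L : List A) {f g : A → ℤ} → (∀ x → f x ≡ g x) → sumZ L f ≡ sumZ L g
sumZ-cong List.[] eq = refl
sumZ-cong (x List.∷ L) eq = cong₂ _+ℤ_ (eq x) (sumZ-cong L eq)

sumZ-pos : ∀ {A : Set} (L : List A) (f : A → ℕ) → + sumL L f ≡ sumZ L (λ x → + f x)
sumZ-pos List.[] f = refl
sumZ-pos (x List.∷ L) f = trans (ZP.pos-+ (f x) (sumL L f)) (cong (_+ℤ_ (+ f x)) (sumZ-pos L f))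

sumZ-linear3 : ∀ {A : Set} (L : List A) (f g k : A → ℕ) (c₁ c₂ c₃ : ℤ) →
  sumZ L (λ x → + f x *ℤ c₁ +ℤ + g x *ℤ c₂ +ℤ + k x *ℤ c₃)
    ≡ + sumL L f *ℤ c₁ +ℤ + sumL L g *ℤ c₂ +ℤ + sumL L k *ℤ c₃
sumZ-linear3 List.[] f g k c₁ c₂ c₃ = sym (empty c₁ c₂ c₃)
  where empty : ∀ (c₁ c₂ c₃ : ℤ) → + 0 *ℤ c₁ +ℤ + 0 *ℤ c₂ +ℤ + 0 *ℤ c₃ ≡ + 0
        empty = solve-∀
sumZ-linear3 (x List.∷ L) f g k c₁ c₂ c₃ = begin
    (+ f x *ℤ c₁ +ℤ + g x *ℤ c₂ +ℤ + k x *ℤ c₃) +ℤ sumZ L (λ x → + f x *ℤ c₁ +ℤ + g x *ℤ c₂ +ℤ + k x *ℤ c₃)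
      ≡⟨ cong (_+ℤ_ (+ f x *ℤ c₁ +ℤ + g x *ℤ c₂ +ℤ + k x *ℤ c₃)) (sumZ-linear3 L f g k c₁ c₂ c₃) ⟩
    (+ f x *ℤ c₁ +ℤ + g x *ℤ c₂ +ℤ + k x *ℤ c₃) +ℤ (+ sumL L f *ℤ c₁ +ℤ + sumL L g *ℤ c₂ +ℤ + sumL L k *ℤ c₃)
      ≡⟨ collect (+ f x) (+ g x) (+ k x) (+ sumL L f) (+ sumL L g) (+ sumL L k) c₁ c₂ c₃ ⟩
    (+ f x +ℤ + sumL L f) *ℤ c₁ +ℤ (+ g x +ℤ + sumL L g) *ℤ c₂ +ℤ (+ k x +ℤ + sumL L k) *ℤ c₃
      ≡⟨ sym (cong₂ _+ℤ_ (cong₂ (λ u v → u *ℤ c₁ +ℤ v *ℤ c₂) (ZP.pos-+ (f x) _) (ZP.pos-+ (g x) _))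
                          (cong (_*ℤ c₃) (ZP.pos-+ (k x) _))) ⟩
    + (f x + sumL L f) *ℤ c₁ +ℤ + (g x + sumL L g) *ℤ c₂ +ℤ + (k x + sumL L k) *ℤ c₃ ∎
  where
    open ≡-Reasoning
    collect : ∀ (a b c s t u c₁ c₂ c₃ : ℤ) →
              (a *ℤ c₁ +ℤ b *ℤ c₂ +ℤ c *ℤ c₃) +ℤ (s *ℤ c₁ +ℤ t *ℤ c₂ +ℤ u *ℤ c₃)
                ≡ (a +ℤ s) *ℤ c₁ +ℤ (b +ℤ t) *ℤ c₂ +ℤ (c +ℤ u) *ℤ c₃
    collect = solve-∀

pos-from-sum : ∀ a b c → a + b ≡ c → + a ≡ + c -ℤ + b
pos-from-sum a b c eq = trans (undo (+ a) (+ b)) (cong (_-ℤ + b) (trans (sym (ZP.pos-+ a b)) (cong +_ eq)))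
  where undo : ∀ (a b : ℤ) → a ≡ (a +ℤ b) -ℤ b
        undo = solve-∀

-- The shape of every per-y count: if T + D·C = D·h and D + c = h
-- (D choices of x, each leaving h - C choices of z, out of h - c admissible x)
-- then T = (h - c)(h - C).
product-count : ∀ T D C c h → T + D * C ≡ D * h → D + c ≡ h → + T ≡ (+ h -ℤ + c) *ℤ (+ h -ℤ + C)
product-count T D C c h e₁ e₂ = begin
    + T                                ≡⟨ undo (+ T) (+ D) (+ C) ⟩
    (+ T +ℤ + D *ℤ + C) -ℤ + D *ℤ + C   ≡⟨ cong (λ k → (+ T +ℤ k) -ℤ + D *ℤ + C) (sym (ZP.pos-* D C)) ⟩
    (+ T +ℤ + (D * C)) -ℤ + D *ℤ + C    ≡⟨ cong (_-ℤ + D *ℤ + C) (trans (sym (ZP.pos-+ T (D * C)))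
                                                             (trans (cong +_ e₁) (ZP.pos-* D h))) ⟩
    + D *ℤ + h -ℤ + D *ℤ + C            ≡⟨ factor (+ D) (+ h) (+ C) ⟩
    + D *ℤ (+ h -ℤ + C)                ≡⟨ cong (_*ℤ (+ h -ℤ + C)) (pos-from-sum D c h e₂) ⟩
    (+ h -ℤ + c) *ℤ (+ h -ℤ + C)       ∎
  where
    open ≡-Reasoning
    undo : ∀ (t d c : ℤ) → t ≡ (t +ℤ d *ℤ c) -ℤ d *ℤ c
    undo = solve-∀
    factor : ∀ (d h c : ℤ) → d *ℤ h -ℤ d *ℤ c ≡ d *ℤ (h -ℤ c)
    factor = solve-∀

-- In case (2), with q = p, s = q^e, r = q^(d-1),
-- h = q^(d+e-1) and P = q^(d+e), the decomposition of N reads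
--   (s - 1)(P - q)(P - q²) + s(r - 1)(h - q)(h - q²) + s(q - 1)r (h - 1)(h - q).
case2-count : (d' e q : ℕ) → ℤ
case2-count d' e q =
     (s -ℤ + 1) *ℤ ((P -ℤ + q) *ℤ (P -ℤ + q ^ 2))
  +ℤ (s *ℤ (r -ℤ + 1)) *ℤ ((h -ℤ + q) *ℤ (h -ℤ + q ^ 2))
  +ℤ (s *ℤ ((+ q -ℤ + 1) *ℤ r)) *ℤ ((h -ℤ + 1) *ℤ (h -ℤ + q))
  where
    s = + (q ^ e)
    r = + (q ^ d')
    h = + (q ^ (d' + e))
    P = + (q * q ^ (d' + e))

-- For q = 2 it is the polynomial of the lemma (note h = rs and P = 2rs).
case2-count-at-2 : ∀ d' e → case2-count d' e 2 ≡
   (+ (2 ^ (suc d' + e ∸ 1)) -ℤ + 2)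
     *ℤ (+ (2 ^ (2 * (suc d' + e) ∸ 1)) +ℤ + 3 *ℤ + (2 ^ (suc d' + 2 * e ∸ 1))
         -ℤ + 9 *ℤ + (2 ^ (suc d' + e ∸ 1)) +ℤ + 4)
case2-count-at-2 d' e = begin
    case2-count d' e 2
      ≡⟨ cong₂ (λ u v → shape (+ s) (+ r) u v) h≡rs (trans (ZP.pos-* 2 (2 ^ (d' + e))) (cong (+ 2 *ℤ_) h≡rs)) ⟩
    shape (+ s) (+ r) (+ r *ℤ + s) (+ 2 *ℤ (+ r *ℤ + s))
      ≡⟨ factorise (+ r) (+ s) ⟩
    (+ r *ℤ + s -ℤ + 2) *ℤ (+ 2 *ℤ ((+ r *ℤ + s) *ℤ (+ r *ℤ + s)) +ℤ + 3 *ℤ (+ r *ℤ (+ s *ℤ + s))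
                           -ℤ + 9 *ℤ (+ r *ℤ + s) +ℤ + 4)
      ≡⟨ sym (cong₃ (λ u v w → (u -ℤ + 2) *ℤ (v +ℤ + 3 *ℤ w -ℤ + 9 *ℤ u +ℤ + 4)) h≡rs 2h²≡ rs²≡) ⟩
    (+ (2 ^ (d' + e)) -ℤ + 2) *ℤ (+ (2 ^ (2 * (suc d' + e) ∸ 1)) +ℤ + 3 *ℤ + (2 ^ (suc d' + 2 * e ∸ 1))
                                 -ℤ + 9 *ℤ + (2 ^ (d' + e)) +ℤ + 4) ∎
  where
    open ≡-Reasoning
    r = 2 ^ d'
    s = 2 ^ e
    m = d' + e
    shape : ℤ → ℤ → ℤ → ℤ → ℤ
    shape s r h P = (s -ℤ + 1) *ℤ ((P -ℤ + 2) *ℤ (P -ℤ + 4))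
                 +ℤ (s *ℤ (r -ℤ + 1)) *ℤ ((h -ℤ + 2) *ℤ (h -ℤ + 4))
                 +ℤ (s *ℤ ((+ 2 -ℤ + 1) *ℤ r)) *ℤ ((h -ℤ + 1) *ℤ (h -ℤ + 2))
    factorise : ∀ (R S : ℤ) →
         (S -ℤ + 1) *ℤ (((+ 2 *ℤ (R *ℤ S)) -ℤ + 2) *ℤ ((+ 2 *ℤ (R *ℤ S)) -ℤ + 4))
      +ℤ (S *ℤ (R -ℤ + 1)) *ℤ (((R *ℤ S) -ℤ + 2) *ℤ ((R *ℤ S) -ℤ + 4))
      +ℤ (S *ℤ ((+ 2 -ℤ + 1) *ℤ R)) *ℤ (((R *ℤ S) -ℤ + 1) *ℤ ((R *ℤ S) -ℤ + 2))
      ≡ (R *ℤ S -ℤ + 2) *ℤ (+ 2 *ℤ ((R *ℤ S) *ℤ (R *ℤ S)) +ℤ + 3 *ℤ (R *ℤ (S *ℤ S)) -ℤ + 9 *ℤ (R *ℤ S) +ℤ + 4)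
    factorise = solve-∀
    cong₃ : ∀ {A : Set} (f : ℤ → ℤ → ℤ → A) {a a' b b' c c'} → a ≡ a' → b ≡ b' → c ≡ c' → f a b c ≡ f a' b' c'
    cong₃ f refl refl refl = refl
    h≡rs : + (2 ^ m) ≡ + r *ℤ + s
    h≡rs = trans (cong +_ (NP.^-distribˡ-+-* 2 d' e)) (ZP.pos-* r s)
    exponent : 2 * (suc d' + e) ∸ 1 ≡ suc (m + m)
    exponent = trans (cong (λ k → m + k) (cong suc (NP.+-identityʳ m))) (NP.+-suc m m)
    2h²≡ : + (2 ^ (2 * (suc d' + e) ∸ 1)) ≡ + 2 *ℤ ((+ r *ℤ + s) *ℤ (+ r *ℤ + s))
    2h²≡ = trans (cong (λ k → + (2 ^ k)) exponent) (trans (ZP.pos-* 2 (2 ^ (m + m)))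
             (cong (+ 2 *ℤ_) (trans (cong +_ (NP.^-distribˡ-+-* 2 m m)) (trans (ZP.pos-* (2 ^ m) (2 ^ m)) (cong₂ _*ℤ_ h≡rs h≡rs)))))
    rs²≡ : + (2 ^ (suc d' + 2 * e ∸ 1)) ≡ + r *ℤ (+ s *ℤ + s)
    rs²≡ = trans (cong +_ (trans (NP.^-distribˡ-+-* 2 d' (2 * e))
                             (cong (r *_) (trans (cong (λ k → 2 ^ (e + k)) (NP.+-identityʳ e)) (NP.^-distribˡ-+-* 2 e e)))))
                 (trans (ZP.pos-* r (s * s)) (cong (+ r *ℤ_) (ZP.pos-* s s)))

module PrimeField (p : ℕ) (pr : Prime p) where
  open Fp p pr

  [_] : ℕ → F
  [ m ] = m mod p

  toℕ-[] : ∀ m → toℕ [ m ] ≡ m % p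
  toℕ-[] m = FinP.toℕ-fromℕ< (m%n<n m p)

  []-cong% : ∀ {m n} → m % p ≡ n % p → [ m ] ≡ [ n ]
  []-cong% {m} {n} eq = FinP.toℕ-injective (trans (toℕ-[] m) (trans eq (sym (toℕ-[] n))))

  []-toℕ : ∀ (a : F) → [ toℕ a ] ≡ a
  []-toℕ a = FinP.toℕ-injective (trans (toℕ-[] (toℕ a)) (m<n⇒m%n≡m (FinP.toℕ<n a)))

  []-+ : ∀ m n → [ m + n ] ≡ [ m ] +F [ n ]
  []-+ m n = []-cong% (trans (%-distribˡ-+ m n p)
                        (cong₂ (λ a b → (a + b) % p) (sym (toℕ-[] m)) (sym (toℕ-[] n))))

  []-* : ∀ m n → [ m * n ] ≡ [ m ] *F [ n ]
  []-* m n = []-cong% (trans (%-distribˡ-* m n p)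
                        (cong₂ (λ a b → (a * b) % p) (sym (toℕ-[] m)) (sym (toℕ-[] n))))

  1<p : 1 < p
  1<p = ℕ.nonTrivial⇒n>1 p {{prime⇒nonTrivial pr}}

  toℕ-1F : toℕ 1F ≡ 1
  toℕ-1F = trans (toℕ-[] 1) (m<n⇒m%n≡m 1<p)

  toℕ-0F : toℕ 0F ≡ 0
  toℕ-0F = trans (toℕ-[] 0) (m<n⇒m%n≡m (NP.<-trans ℕ.z<s 1<p))

  1≢0 : 1F ≢ 0F
  1≢0 eq with trans (sym toℕ-1F) (trans (cong toℕ eq) toℕ-0F)
  ... | ()

  [p]≡0 : [ p ] ≡ 0F
  [p]≡0 = []-cong% (trans (n%n≡0 p) (sym (m<n⇒m%n≡m (NP.<-trans ℕ.z<s 1<p))))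

  +-comm : ∀ a b → a +F b ≡ b +F a
  +-comm a b = cong [_] (NP.+-comm (toℕ a) (toℕ b))

  *-comm : ∀ a b → a *F b ≡ b *F a
  *-comm a b = cong [_] (NP.*-comm (toℕ a) (toℕ b))

  +-assoc : ∀ a b c → (a +F b) +F c ≡ a +F (b +F c)
  +-assoc a b c = begin
      (a +F b) +F c           ≡⟨ cong ((a +F b) +F_) (sym ([]-toℕ c)) ⟩
      [ ta + tb ] +F [ tc ]   ≡⟨ sym ([]-+ (ta + tb) tc) ⟩
      [ ta + tb + tc ]        ≡⟨ cong [_] (NP.+-assoc ta tb tc) ⟩
      [ ta + (tb + tc) ]      ≡⟨ []-+ ta (tb + tc) ⟩
      [ ta ] +F (b +F c)      ≡⟨ cong (_+F (b +F c)) ([]-toℕ a) ⟩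
      a +F (b +F c)           ∎
    where open ≡-Reasoning
          ta = toℕ a ; tb = toℕ b ; tc = toℕ c

  *-assoc : ∀ a b c → (a *F b) *F c ≡ a *F (b *F c)
  *-assoc a b c = begin
      (a *F b) *F c           ≡⟨ cong ((a *F b) *F_) (sym ([]-toℕ c)) ⟩
      [ ta * tb ] *F [ tc ]   ≡⟨ sym ([]-* (ta * tb) tc) ⟩
      [ ta * tb * tc ]        ≡⟨ cong [_] (NP.*-assoc ta tb tc) ⟩
      [ ta * (tb * tc) ]      ≡⟨ []-* ta (tb * tc) ⟩
      [ ta ] *F (b *F c)      ≡⟨ cong (_*F (b *F c)) ([]-toℕ a) ⟩
      a *F (b *F c)           ∎
    where open ≡-Reasoning
          ta = toℕ a ; tb = toℕ b ; tc = toℕ c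

  distribˡ : ∀ a b c → a *F (b +F c) ≡ (a *F b) +F (a *F c)
  distribˡ a b c = begin
      a *F (b +F c)            ≡⟨ cong (_*F (b +F c)) (sym ([]-toℕ a)) ⟩
      [ ta ] *F [ tb + tc ]    ≡⟨ sym ([]-* ta (tb + tc)) ⟩
      [ ta * (tb + tc) ]       ≡⟨ cong [_] (NP.*-distribˡ-+ ta tb tc) ⟩
      [ ta * tb + ta * tc ]    ≡⟨ []-+ (ta * tb) (ta * tc) ⟩
      (a *F b) +F (a *F c)     ∎
    where open ≡-Reasoning
          ta = toℕ a ; tb = toℕ b ; tc = toℕ c

  distribʳ : ∀ a b c → (b +F c) *F a ≡ (b *F a) +F (c *F a)
  distribʳ a b c = trans (*-comm (b +F c) a) (trans (distribˡ a b c) (cong₂ _+F_ (*-comm a b) (*-comm a c)))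

  +-identityˡ : ∀ a → 0F +F a ≡ a
  +-identityˡ a = trans (cong (λ k → [ k + toℕ a ]) toℕ-0F) ([]-toℕ a)

  +-identityʳ : ∀ a → a +F 0F ≡ a
  +-identityʳ a = trans (+-comm a 0F) (+-identityˡ a)

  *-identityˡ : ∀ a → 1F *F a ≡ a
  *-identityˡ a = trans (cong (λ k → [ k * toℕ a ]) toℕ-1F) (trans (cong [_] (NP.*-identityˡ (toℕ a))) ([]-toℕ a))

  *-identityʳ : ∀ a → a *F 1F ≡ a
  *-identityʳ a = trans (*-comm a 1F) (*-identityˡ a)

  *-zeroˡ : ∀ a → 0F *F a ≡ 0F
  *-zeroˡ a = cong (λ k → [ k * toℕ a ]) toℕ-0F

  *-zeroʳ : ∀ a → a *F 0F ≡ 0F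
  *-zeroʳ a = trans (*-comm a 0F) (*-zeroˡ a)

  -‿inverseʳ : ∀ a → a +F (-F a) ≡ 0F
  -‿inverseʳ a = begin
      a +F (-F a)                  ≡⟨ cong (_+F (-F a)) (sym ([]-toℕ a)) ⟩
      [ toℕ a ] +F [ p ∸ toℕ a ]   ≡⟨ sym ([]-+ (toℕ a) (p ∸ toℕ a)) ⟩
      [ toℕ a + (p ∸ toℕ a) ]      ≡⟨ cong [_] (NP.m+[n∸m]≡n (NP.<⇒≤ (FinP.toℕ<n a))) ⟩
      [ p ]                        ≡⟨ [p]≡0 ⟩
      0F                           ∎
    where open ≡-Reasoning

  -‿inverseˡ : ∀ a → (-F a) +F a ≡ 0F
  -‿inverseˡ a = trans (+-comm (-F a) a) (-‿inverseʳ a)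

  -‿unique : ∀ a b → a +F b ≡ 0F → b ≡ -F a
  -‿unique a b eq = begin
      b                    ≡⟨ sym (+-identityˡ b) ⟩
      0F +F b              ≡⟨ cong (_+F b) (sym (-‿inverseˡ a)) ⟩
      ((-F a) +F a) +F b   ≡⟨ +-assoc (-F a) a b ⟩
      (-F a) +F (a +F b)   ≡⟨ cong ((-F a) +F_) eq ⟩
      (-F a) +F 0F         ≡⟨ +-identityʳ (-F a) ⟩
      -F a                 ∎
    where open ≡-Reasoning

  -‿involutive : ∀ a → -F (-F a) ≡ a
  -‿involutive a = sym (-‿unique (-F a) a (-‿inverseˡ a))

  -‿zero : -F 0F ≡ 0F
  -‿zero = sym (-‿unique 0F 0F (+-identityˡ 0F))

  difference-zero : ∀ a a' → a +F (-F a') ≡ 0F → a ≡ a'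
  difference-zero a a' e =
    trans (sym (-‿involutive a)) (trans (cong -F_ (sym (-‿unique a (-F a') e))) (-‿involutive a'))

  *-negˡ : ∀ a b → (-F a) *F b ≡ -F (a *F b)
  *-negˡ a b = -‿unique (a *F b) ((-F a) *F b)
    (trans (sym (distribʳ b a (-F a))) (trans (cong (_*F b) (-‿inverseʳ a)) (*-zeroˡ b)))

  toℕ≡0 : ∀ a → toℕ a ≡ 0 → a ≡ 0F
  toℕ≡0 a eq = FinP.toℕ-injective (trans eq (sym toℕ-0F))

  no-zero-divisors : ∀ a b → a *F b ≡ 0F → a ≡ 0F ⊎ b ≡ 0F
  no-zero-divisors a b eq with euclidsLemma (toℕ a) (toℕ b) pr
      (m%n≡0⇒n∣m _ p (trans (sym (toℕ-[] (toℕ a * toℕ b))) (trans (cong toℕ eq) toℕ-0F)))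
  ... | inj₁ p∣a = inj₁ (toℕ≡0 a (trans (sym (m<n⇒m%n≡m (FinP.toℕ<n a))) (n∣m⇒m%n≡0 _ p p∣a)))
  ... | inj₂ p∣b = inj₂ (toℕ≡0 b (trans (sym (m<n⇒m%n≡m (FinP.toℕ<n b))) (n∣m⇒m%n≡0 _ p p∣b)))

  inverse : ∀ a → a ≢ 0F → Σ F (λ b → b *F a ≡ 1F)
  inverse a a≢0 = from-Bézout (coprime-Bézout (prime⇒coprime pr {{nonzero}} (FinP.toℕ<n a)))
    where
      nonzero : NonZero (toℕ a)
      nonzero = ℕ.≢-nonZero (λ e → a≢0 (toℕ≡0 a e))
      scale : ∀ y → [ y ] *F a ≡ [ y * toℕ a ]
      scale y = trans (cong ([ y ] *F_) (sym ([]-toℕ a))) (sym ([]-* y (toℕ a)))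
      multiple-of-p : ∀ x → [ x * p ] ≡ 0F
      multiple-of-p x = trans ([]-* x p) (trans (cong ([ x ] *F_) [p]≡0) (*-zeroʳ [ x ]))
      from-Bézout : Bézout.Identity 1 p (toℕ a) → Σ F (λ b → b *F a ≡ 1F)
      from-Bézout (Bézout.-+ x y eq) = [ y ] , (begin
          [ y ] *F a        ≡⟨ scale y ⟩
          [ y * toℕ a ]     ≡⟨ cong [_] (sym eq) ⟩
          [ 1 + x * p ]     ≡⟨ []-+ 1 (x * p) ⟩
          1F +F [ x * p ]   ≡⟨ cong (1F +F_) (multiple-of-p x) ⟩
          1F +F 0F          ≡⟨ +-identityʳ 1F ⟩
          1F                ∎)
        where open ≡-Reasoning
      from-Bézout (Bézout.+- x y eq) = -F [ y ] , (begin
          (-F [ y ]) *F a      ≡⟨ *-negˡ [ y ] a ⟩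
          -F ([ y ] *F a)      ≡⟨ cong -F_ (scale y) ⟩
          -F [ y * toℕ a ]     ≡⟨ cong -F_ (-‿unique 1F [ y * toℕ a ]
                                   (trans (sym ([]-+ 1 (y * toℕ a))) (trans (cong [_] eq) (multiple-of-p x)))) ⟩
          -F (-F 1F)           ≡⟨ -‿involutive 1F ⟩
          1F                   ∎)
        where open ≡-Reasoning

  char-two : 1F ≡ -F 1F → p ≡ 2
  char-two e = p-1≡1⇒p≡2 p refl 1<p
    (trans (sym toℕ-1F) (trans (cong toℕ e) (trans (toℕ-[] (p ∸ toℕ 1F))
      (trans (cong (λ k → (p ∸ k) % p) toℕ-1F) (m<n⇒m%n≡m (pred< p 1<p))))))
    where
      pred< : ∀ k → 1 < k → k ∸ 1 < k
      pred< (suc k) _ = NP.n<1+n k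
      p-1≡1⇒p≡2 : ∀ k → k ≡ p → 1 < k → 1 ≡ k ∸ 1 → p ≡ 2
      p-1≡1⇒p≡2 (suc (suc zero)) refl _ _ = refl
      p-1≡1⇒p≡2 (suc (suc (suc k))) _ _ ()

  _≟V_ : ∀ {n} → DecidableEquality (Vect n)
  _≟V_ = VecP.≡-dec _≟_

  +V-assoc : ∀ {n} (x y z : Vect n) → (x +V y) +V z ≡ x +V (y +V z)
  +V-assoc [] [] [] = refl
  +V-assoc (a ∷ x) (b ∷ y) (c ∷ z) = cong₂ _∷_ (+-assoc a b c) (+V-assoc x y z)

  +V-comm : ∀ {n} (x y : Vect n) → x +V y ≡ y +V x
  +V-comm [] [] = refl
  +V-comm (a ∷ x) (b ∷ y) = cong₂ _∷_ (+-comm a b) (+V-comm x y)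

  +V-identityˡ : ∀ {n} (x : Vect n) → 0V +V x ≡ x
  +V-identityˡ [] = refl
  +V-identityˡ (a ∷ x) = cong₂ _∷_ (+-identityˡ a) (+V-identityˡ x)

  +V-identityʳ : ∀ {n} (x : Vect n) → x +V 0V ≡ x
  +V-identityʳ x = trans (+V-comm x 0V) (+V-identityˡ x)

  ·V-distribˡ : ∀ {n} c (x y : Vect n) → c ·V (x +V y) ≡ (c ·V x) +V (c ·V y)
  ·V-distribˡ c [] [] = refl
  ·V-distribˡ c (a ∷ x) (b ∷ y) = cong₂ _∷_ (distribˡ c a b) (·V-distribˡ c x y)

  ·V-distribʳ : ∀ {n} a b (x : Vect n) → (a +F b) ·V x ≡ (a ·V x) +V (b ·V x)
  ·V-distribʳ a b [] = refl
  ·V-distribʳ a b (c ∷ x) = cong₂ _∷_ (distribʳ c a b) (·V-distribʳ a b x)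

  ·V-assoc : ∀ {n} a b (x : Vect n) → (a *F b) ·V x ≡ a ·V (b ·V x)
  ·V-assoc a b [] = refl
  ·V-assoc a b (c ∷ x) = cong₂ _∷_ (*-assoc a b c) (·V-assoc a b x)

  ·V-identity : ∀ {n} (x : Vect n) → 1F ·V x ≡ x
  ·V-identity [] = refl
  ·V-identity (c ∷ x) = cong₂ _∷_ (*-identityˡ c) (·V-identity x)

  ·V-zeroˡ : ∀ {n} (x : Vect n) → 0F ·V x ≡ 0V
  ·V-zeroˡ [] = refl
  ·V-zeroˡ (c ∷ x) = cong₂ _∷_ (*-zeroˡ c) (·V-zeroˡ x)

  ·V-zeroʳ : ∀ {n} c → c ·V (0V {n}) ≡ 0V
  ·V-zeroʳ {zero} c = refl
  ·V-zeroʳ {suc n} c = cong₂ _∷_ (*-zeroʳ c) (·V-zeroʳ c)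

  interchange : ∀ {n} (u v w t : Vect n) → (u +V v) +V (w +V t) ≡ (u +V w) +V (v +V t)
  interchange u v w t = begin
      (u +V v) +V (w +V t)   ≡⟨ +V-assoc u v (w +V t) ⟩
      u +V (v +V (w +V t))   ≡⟨ cong (u +V_) (sym (+V-assoc v w t)) ⟩
      u +V ((v +V w) +V t)   ≡⟨ cong (λ k → u +V (k +V t)) (+V-comm v w) ⟩
      u +V ((w +V v) +V t)   ≡⟨ cong (u +V_) (+V-assoc w v t) ⟩
      u +V (w +V (v +V t))   ≡⟨ sym (+V-assoc u w (v +V t)) ⟩
      (u +V w) +V (v +V t)   ∎
    where open ≡-Reasoning

  ·V-inverseʳ : ∀ {n} c (y : Vect n) → (c ·V y) +V ((-F c) ·V y) ≡ 0V
  ·V-inverseʳ c y = trans (sym (·V-distribʳ c (-F c) y)) (trans (cong (_·V y) (-‿inverseʳ c)) (·V-zeroˡ y))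

  ·V-inverseˡ : ∀ {n} c (x : Vect n) → ((-F c) ·V x) +V (c ·V x) ≡ 0V
  ·V-inverseˡ c x = trans (+V-comm _ _) (·V-inverseʳ c x)

  ·V-combination : ∀ {n} k a b (x y : Vect n) →
                   k ·V ((a ·V x) +V (b ·V y)) ≡ ((k *F a) ·V x) +V ((k *F b) ·V y)
  ·V-combination k a b x y = trans (·V-distribˡ k _ _) (sym (cong₂ _+V_ (·V-assoc k a x) (·V-assoc k b y)))

  ·V-no-zero-divisors : ∀ {n} c (x : Vect n) → c ·V x ≡ 0V → c ≡ 0F ⊎ x ≡ 0V
  ·V-no-zero-divisors c x eq with c ≟ 0F
  ... | yes c≡0 = inj₁ c≡0
  ... | no c≢0 with inverse c c≢0
  ...   | (c⁻¹ , c⁻¹c) = inj₂ (begin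
      x                 ≡⟨ sym (·V-identity x) ⟩
      1F ·V x           ≡⟨ cong (_·V x) (sym c⁻¹c) ⟩
      (c⁻¹ *F c) ·V x   ≡⟨ ·V-assoc c⁻¹ c x ⟩
      c⁻¹ ·V (c ·V x)   ≡⟨ cong (c⁻¹ ·V_) eq ⟩
      c⁻¹ ·V 0V         ≡⟨ ·V-zeroʳ c⁻¹ ⟩
      0V                ∎)
    where open ≡-Reasoning

  solve-for : ∀ {n} c (z w : Vect n) → c ≢ 0F → (c ·V z) +V w ≡ 0V → Σ F (λ k → z ≡ k ·V w)
  solve-for c z w c≢0 eq with inverse c c≢0
  ... | c⁻¹ , c⁻¹c = -F c⁻¹ , (begin
      z                                               ≡⟨ sym (·V-identity z) ⟩
      1F ·V z                                         ≡⟨ cong (_·V z) (sym c⁻¹c) ⟩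
      (c⁻¹ *F c) ·V z                                 ≡⟨ ·V-assoc c⁻¹ c z ⟩
      c⁻¹ ·V (c ·V z)                                 ≡⟨ sym (+V-identityʳ _) ⟩
      (c⁻¹ ·V (c ·V z)) +V 0V                         ≡⟨ cong ((c⁻¹ ·V (c ·V z)) +V_) (sym (·V-inverseʳ c⁻¹ w)) ⟩
      (c⁻¹ ·V (c ·V z)) +V ((c⁻¹ ·V w) +V ((-F c⁻¹) ·V w)) ≡⟨ sym (+V-assoc _ _ _) ⟩
      ((c⁻¹ ·V (c ·V z)) +V (c⁻¹ ·V w)) +V ((-F c⁻¹) ·V w) ≡⟨ cong (_+V ((-F c⁻¹) ·V w)) (sym (·V-distribˡ c⁻¹ _ _)) ⟩
      (c⁻¹ ·V ((c ·V z) +V w)) +V ((-F c⁻¹) ·V w)     ≡⟨ cong (λ k → (c⁻¹ ·V k) +V ((-F c⁻¹) ·V w)) eq ⟩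
      (c⁻¹ ·V 0V) +V ((-F c⁻¹) ·V w)                  ≡⟨ cong (_+V ((-F c⁻¹) ·V w)) (·V-zeroʳ c⁻¹) ⟩
      0V +V ((-F c⁻¹) ·V w)                           ≡⟨ +V-identityˡ _ ⟩
      (-F c⁻¹) ·V w                                   ∎)
    where open ≡-Reasoning

  sumFin : ∀ n → (Fin n → ℕ) → ℕ
  sumFin zero f = 0
  sumFin (suc n) f = f Fin.zero + sumFin n (λ i → f (Fin.suc i))

  sumL-tabulate : ∀ {A : Set} n (g : Fin n → A) (f : A → ℕ) → sumL (tabulate g) f ≡ sumFin n (λ i → f (g i))
  sumL-tabulate zero g f = refl
  sumL-tabulate (suc n) g f = cong (λ k → f (g Fin.zero) + k) (sumL-tabulate n (λ i → g (Fin.suc i)) f)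

  sumFin-cong : ∀ n {f g : Fin n → ℕ} → (∀ i → f i ≡ g i) → sumFin n f ≡ sumFin n g
  sumFin-cong zero eq = refl
  sumFin-cong (suc n) eq = cong₂ _+_ (eq Fin.zero) (sumFin-cong n (λ i → eq (Fin.suc i)))

  sumFin-point : ∀ n (a : Fin n) → sumFin n (λ x → ind (x ≟ a)) ≡ 1
  sumFin-point (suc n) Fin.zero = cong suc (sumFin-shifted n)
    where sumFin-shifted : ∀ m → sumFin m (λ x → ind (Fin.suc x ≟ Fin.zero)) ≡ 0
          sumFin-shifted zero = refl
          sumFin-shifted (suc m) = sumFin-shifted m
  sumFin-point (suc n) (Fin.suc a) =
    trans (sumFin-cong n (λ x → ind-cong FinP.suc-injective (cong Fin.suc) (Fin.suc x ≟ Fin.suc a) (x ≟ a)))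
          (sumFin-point n a)

  sumFin-one : ∀ n → sumFin n (λ _ → 1) ≡ n
  sumFin-one zero = refl
  sumFin-one (suc n) = cong suc (sumFin-one n)

  enumF : ∀ (a : F) → sumL (allFin p) (λ x → ind (x ≟ a)) ≡ 1
  enumF a = trans (sumL-tabulate p (λ i → i) _) (sumFin-point p a)

  |F| : sumL (allFin p) (λ _ → 1) ≡ p
  |F| = trans (sumL-tabulate p (λ i → i) _) (sumFin-one p)

  sumV-suc : ∀ n (f : Vect (suc n) → ℕ) →
             sumL (allVecs (suc n)) f ≡ sumL (allFin p) (λ a → sumL (allVecs n) (λ v → f (a ∷ v)))
  sumV-suc n f = trans (sumL-concatMap _ (allFin p) f) (sumL-cong (allFin p) (λ a → sumL-map (a ∷_) (allVecs n) f))

  enumV : ∀ n (a : Vect n) → sumL (allVecs n) (λ x → ind (x ≟V a)) ≡ 1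
  enumV zero [] = refl
  enumV (suc n) (c ∷ a) = begin
      sumL (allVecs (suc n)) (λ x → ind (x ≟V (c ∷ a)))                            ≡⟨ sumV-suc n _ ⟩
      sumL (allFin p) (λ b → sumL (allVecs n) (λ v → ind ((b ∷ v) ≟V (c ∷ a))))      ≡⟨ sumL-cong (allFin p) (λ b →
                                                                                        sumL-cong (allVecs n) (λ v → ind-∷ b v)) ⟩
      sumL (allFin p) (λ b → sumL (allVecs n) (λ v → ind (b ≟ c) * ind (v ≟V a)))    ≡⟨ sumL-cong (allFin p) (λ b →
                                                                                        sumL-*ˡ (allVecs n) (ind (b ≟ c)) _) ⟩
      sumL (allFin p) (λ b → ind (b ≟ c) * sumL (allVecs n) (λ v → ind (v ≟V a)))    ≡⟨ sumL-cong (allFin p) (λ b →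
                                                                                        cong (ind (b ≟ c) *_) (enumV n a)) ⟩
      sumL (allFin p) (λ b → ind (b ≟ c) * 1)                                        ≡⟨ sumL-*ʳ (allFin p) 1 _ ⟩
      sumL (allFin p) (λ b → ind (b ≟ c)) * 1                                        ≡⟨ cong (_* 1) (enumF c) ⟩
      1                                                                              ∎
    where
      open ≡-Reasoning
      ind-∷ : ∀ b v → ind ((b ∷ v) ≟V (c ∷ a)) ≡ ind (b ≟ c) * ind (v ≟V a)
      ind-∷ b v = trans (ind-cong VecP.∷-injective (λ { (e₁ , e₂) → cong₂ _∷_ e₁ e₂ })
                                  ((b ∷ v) ≟V (c ∷ a)) ((b ≟ c) ×-dec (v ≟V a)))
                        (ind-× (b ≟ c) (v ≟V a) ((b ≟ c) ×-dec (v ≟V a)))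

  |Vect| : ∀ n → sumL (allVecs n) (λ _ → 1) ≡ p ^ n
  |Vect| zero = refl
  |Vect| (suc n) = begin
      sumL (allVecs (suc n)) (λ _ → 1)                    ≡⟨ sumV-suc n _ ⟩
      sumL (allFin p) (λ a → sumL (allVecs n) (λ _ → 1))  ≡⟨ sumL-cong (allFin p) (λ _ → |Vect| n) ⟩
      sumL (allFin p) (λ a → p ^ n)                       ≡⟨ sumL-const (allFin p) (p ^ n) ⟩
      sumL (allFin p) (λ _ → 1) * p ^ n                   ≡⟨ cong (_* p ^ n) |F| ⟩
      p * p ^ n                                           ∎
    where open ≡-Reasoning

  sumV-const : ∀ m c → sumL (allVecs m) (λ _ → c) ≡ p ^ m * c
  sumV-const m c = trans (sumL-const (allVecs m) c) (cong (_* c) (|Vect| m))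

  sumV-++ : ∀ d e (f : Vect (d + e) → ℕ) →
      sumL (allVecs (d + e)) f ≡ sumL (allVecs d) (λ a → sumL (allVecs e) (λ b → f (a ++ b)))
  sumV-++ zero e f = sym (NP.+-identityʳ _)
  sumV-++ (suc d) e f = begin
      sumL (allVecs (suc d + e)) f                                                           ≡⟨ sumV-suc (d + e) f ⟩
      sumL (allFin p) (λ c → sumL (allVecs (d + e)) (λ v → f (c ∷ v)))                       ≡⟨ sumL-cong (allFin p) (λ c →
                                                                                             sumV-++ d e (λ v → f (c ∷ v))) ⟩
      sumL (allFin p) (λ c → sumL (allVecs d) (λ a → sumL (allVecs e) (λ b → f (c ∷ (a ++ b))))) ≡⟨ sym (sumV-suc d _) ⟩
      sumL (allVecs (suc d)) (λ a → sumL (allVecs e) (λ b → f (a ++ b)))                        ∎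
    where open ≡-Reasoning

  module EnumF = Enumeration _≟_ (allFin p) enumF
  module EnumV (n : ℕ) = Enumeration (_≟V_ {n}) (allVecs n) (enumV n)

  nonzero-count : ∀ m → sumL (allVecs m) (λ b → ind (¬? (b ≟V 0V))) + 1 ≡ p ^ m
  nonzero-count m = trans (EnumV.count-others m 0V) (|Vect| m)

  LinIndep2 : ∀ {n} → Vect n → Vect n → Set
  LinIndep2 x y = ∀ a b → (a ·V x) +V (b ·V y) ≡ 0V → (a ≡ 0F) × (b ≡ 0F)

  InSpan2 : ∀ {n} → Vect n → Vect n → Vect n → Set
  InSpan2 z x y = Σ F (λ a → Σ F (λ b → z ≡ (a ·V x) +V (b ·V y)))

  inSpan2? : ∀ {n} (z x y : Vect n) → Dec (InSpan2 z x y)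
  inSpan2? z x y = FinP.any? (λ a → FinP.any? (λ b → z ≟V ((a ·V x) +V (b ·V y))))

  InSpan1 : ∀ {n} → Vect n → Vect n → Set
  InSpan1 z y = Σ F (λ a → z ≡ a ·V y)

  inSpan1? : ∀ {n} (z y : Vect n) → Dec (InSpan1 z y)
  inSpan1? z y = FinP.any? (λ a → z ≟V (a ·V y))

  indep3⇒indep2 : ∀ {n} (x y z : Vect n) → LinIndep3 x y z → LinIndep2 x y
  indep3⇒indep2 x y z li a b eq with li a b 0F (begin
      (a ·V x) +V ((b ·V y) +V (0F ·V z)) ≡⟨ cong (λ k → (a ·V x) +V ((b ·V y) +V k)) (·V-zeroˡ z) ⟩
      (a ·V x) +V ((b ·V y) +V 0V)        ≡⟨ cong ((a ·V x) +V_) (+V-identityʳ _) ⟩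
      (a ·V x) +V (b ·V y)                ≡⟨ eq ⟩
      0V                                  ∎)
    where open ≡-Reasoning
  ... | a≡0 , b≡0 , _ = a≡0 , b≡0

  indep3⇒∉span : ∀ {n} (x y z : Vect n) → LinIndep3 x y z → ¬ InSpan2 z x y
  indep3⇒∉span x y z li (a , b , e) with li (-F a) (-F b) 1F (begin
      ((-F a) ·V x) +V (((-F b) ·V y) +V (1F ·V z))               ≡⟨ cong (λ k → ((-F a) ·V x) +V (((-F b) ·V y) +V k))
                                                                        (trans (·V-identity z) e) ⟩
      ((-F a) ·V x) +V (((-F b) ·V y) +V ((a ·V x) +V (b ·V y)))  ≡⟨ sym (+V-assoc _ _ _) ⟩
      (((-F a) ·V x) +V ((-F b) ·V y)) +V ((a ·V x) +V (b ·V y))  ≡⟨ interchange _ _ _ _ ⟩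
      (((-F a) ·V x) +V (a ·V x)) +V (((-F b) ·V y) +V (b ·V y))  ≡⟨ cong₂ _+V_ (·V-inverseˡ a x) (·V-inverseˡ b y) ⟩
      0V +V 0V                                                    ≡⟨ +V-identityˡ 0V ⟩
      0V                                                          ∎)
    where open ≡-Reasoning
  ... | _ , _ , 1≡0 = 1≢0 1≡0

  indep2+∉span⇒indep3 : ∀ {n} (x y z : Vect n) → LinIndep2 x y → ¬ InSpan2 z x y → LinIndep3 x y z
  indep2+∉span⇒indep3 x y z i2 z∉ a b c eq with c ≟ 0F
  ... | yes refl = let r = i2 a b (trans (cong ((a ·V x) +V_)
                                            (sym (trans (cong ((b ·V y) +V_) (·V-zeroˡ z)) (+V-identityʳ _)))) eq)
                   in proj₁ r , proj₂ r , refl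
  ... | no c≢0 with solve-for c z ((a ·V x) +V (b ·V y)) c≢0 (begin
      (c ·V z) +V ((a ·V x) +V (b ·V y)) ≡⟨ +V-comm _ _ ⟩
      ((a ·V x) +V (b ·V y)) +V (c ·V z) ≡⟨ +V-assoc _ _ _ ⟩
      (a ·V x) +V ((b ·V y) +V (c ·V z)) ≡⟨ eq ⟩
      0V                                 ∎)
    where open ≡-Reasoning
  ...   | k , e = ⊥-elim (z∉ ((k *F a) , (k *F b) , trans e (·V-combination k a b x y)))

  indep2⇒∉span : ∀ {n} (x y : Vect n) → LinIndep2 x y → ¬ InSpan1 x y
  indep2⇒∉span x y i2 (c , e) =
    1≢0 (proj₁ (i2 1F (-F c) (trans (cong (_+V ((-F c) ·V y)) (trans (·V-identity x) e)) (·V-inverseʳ c y))))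

  ∉span⇒indep2 : ∀ {n} (x y : Vect n) → y ≢ 0V → ¬ InSpan1 x y → LinIndep2 x y
  ∉span⇒indep2 x y y≢0 x∉ a b eq with a ≟ 0F
  ... | no a≢0 with solve-for a x (b ·V y) a≢0 eq
  ...   | k , e = ⊥-elim (x∉ ((k *F b) , trans e (sym (·V-assoc k b y))))
  ∉span⇒indep2 x y y≢0 x∉ a b eq | yes refl
    with ·V-no-zero-divisors b y (trans (sym (+V-identityˡ _)) (trans (cong (_+V (b ·V y)) (sym (·V-zeroˡ x))) eq))
  ... | inj₁ b≡0 = refl , b≡0
  ... | inj₂ y≡0 = ⊥-elim (y≢0 y≡0)

  coordinates-unique2 : ∀ {n} (x y : Vect n) → LinIndep2 x y → ∀ a b a' b' →
       (a ·V x) +V (b ·V y) ≡ (a' ·V x) +V (b' ·V y) → (a ≡ a') × (b ≡ b')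
  coordinates-unique2 x y i2 a b a' b' eq with i2 (a +F (-F a')) (b +F (-F b')) (begin
      ((a +F (-F a')) ·V x) +V ((b +F (-F b')) ·V y)                ≡⟨ cong₂ _+V_ (·V-distribʳ a (-F a') x)
                                                                                  (·V-distribʳ b (-F b') y) ⟩
      ((a ·V x) +V ((-F a') ·V x)) +V ((b ·V y) +V ((-F b') ·V y))   ≡⟨ interchange _ _ _ _ ⟩
      ((a ·V x) +V (b ·V y)) +V (((-F a') ·V x) +V ((-F b') ·V y))   ≡⟨ cong (_+V (((-F a') ·V x) +V ((-F b') ·V y))) eq ⟩
      ((a' ·V x) +V (b' ·V y)) +V (((-F a') ·V x) +V ((-F b') ·V y)) ≡⟨ interchange _ _ _ _ ⟩
      ((a' ·V x) +V ((-F a') ·V x)) +V ((b' ·V y) +V ((-F b') ·V y)) ≡⟨ cong₂ _+V_ (·V-inverseʳ a' x) (·V-inverseʳ b' y) ⟩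
      0V +V 0V                                                      ≡⟨ +V-identityˡ 0V ⟩
      0V                                                            ∎)
    where open ≡-Reasoning
  ... | e₁ , e₂ = difference-zero a a' e₁ , difference-zero b b' e₂

  coordinates-unique1 : ∀ {n} (y : Vect n) → y ≢ 0V → ∀ a a' → a ·V y ≡ a' ·V y → a ≡ a'
  coordinates-unique1 y y≢0 a a' eq with ·V-no-zero-divisors (a +F (-F a')) y (begin
      (a +F (-F a')) ·V y         ≡⟨ ·V-distribʳ a (-F a') y ⟩
      (a ·V y) +V ((-F a') ·V y)  ≡⟨ cong (_+V ((-F a') ·V y)) eq ⟩
      (a' ·V y) +V ((-F a') ·V y) ≡⟨ ·V-inverseʳ a' y ⟩
      0V                          ∎)
    where open ≡-Reasoning
  ... | inj₁ e = difference-zero a a' e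
  ... | inj₂ e = ⊥-elim (y≢0 e)

  -- A plane has p² points: z ↦ its coordinates is a bijection onto F_p².
  |span2| : ∀ {n} (x y : Vect n) → LinIndep2 x y → sumL (allVecs n) (λ z → ind (inSpan2? z x y)) ≡ p * p
  |span2| {n} x y i2 = begin
      sumL (allVecs n) (λ z → ind (inSpan2? z x y))
        ≡⟨ sumL-cong (allVecs n) (λ z → EnumF.unique (λ a → FinP.any? (λ b → z ≟V (xy a b)))
             (λ { a a' (b , e) (b' , e') → proj₁ (coordinates-unique2 x y i2 a b a' b' (trans (sym e) e')) })
             (inSpan2? z x y)) ⟩
      sumL (allVecs n) (λ z → sumL (allFin p) (λ a → ind (FinP.any? (λ b → z ≟V (xy a b)))))
        ≡⟨ sumL-cong (allVecs n) (λ z → sumL-cong (allFin p) (λ a → EnumF.unique (λ b → z ≟V (xy a b))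
             (λ b b' e e' → proj₂ (coordinates-unique2 x y i2 a b a b' (trans (sym e) e'))) _)) ⟩
      sumL (allVecs n) (λ z → sumL (allFin p) (λ a → sumL (allFin p) (λ b → ind (z ≟V (xy a b)))))
        ≡⟨ sumL-swap (allVecs n) (allFin p) _ ⟩
      sumL (allFin p) (λ a → sumL (allVecs n) (λ z → sumL (allFin p) (λ b → ind (z ≟V (xy a b)))))
        ≡⟨ sumL-cong (allFin p) (λ a → sumL-swap (allVecs n) (allFin p) _) ⟩
      sumL (allFin p) (λ a → sumL (allFin p) (λ b → sumL (allVecs n) (λ z → ind (z ≟V (xy a b)))))
        ≡⟨ sumL-cong (allFin p) (λ a → trans (sumL-cong (allFin p) (λ b → enumV n (xy a b))) |F|) ⟩
      sumL (allFin p) (λ a → p)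
        ≡⟨ trans (sumL-const (allFin p) p) (cong (_* p) |F|) ⟩
      p * p ∎
    where
      open ≡-Reasoning
      xy : F → F → Vect _
      xy a b = (a ·V x) +V (b ·V y)

  |span1| : ∀ {n} (y : Vect n) → y ≢ 0V → sumL (allVecs n) (λ z → ind (inSpan1? z y)) ≡ p
  |span1| {n} y y≢0 = begin
      sumL (allVecs n) (λ z → ind (inSpan1? z y))
        ≡⟨ sumL-cong (allVecs n) (λ z → EnumF.unique (λ a → z ≟V (a ·V y))
             (λ a a' e e' → coordinates-unique1 y y≢0 a a' (trans (sym e) e')) (inSpan1? z y)) ⟩
      sumL (allVecs n) (λ z → sumL (allFin p) (λ a → ind (z ≟V (a ·V y)))) ≡⟨ sumL-swap (allVecs n) (allFin p) _ ⟩
      sumL (allFin p) (λ a → sumL (allVecs n) (λ z → ind (z ≟V (a ·V y)))) ≡⟨ sumL-cong (allFin p) (λ a → enumV n _) ⟩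
      sumL (allFin p) (λ a → 1)                                          ≡⟨ |F| ⟩
      p                                                                  ∎
    where open ≡-Reasoning

  module SkewForm (n : ℕ) (B : Vect n → Vect n → F) (bil : IsBilinear B) (skew : IsSkewSymmetric B) where
    open IsBilinear bil

    B-right-zero : ∀ y → B y 0V ≡ 0F
    B-right-zero y = trans (cong (B y) (sym (·V-zeroˡ 0V))) (trans (·-right 0F y 0V) (*-zeroˡ _))

    B-right-combination : ∀ y a x b z → B y ((a ·V x) +V (b ·V z)) ≡ (a *F B y x) +F (b *F B y z)
    B-right-combination y a x b z = trans (+-right y _ _) (cong₂ _+F_ (·-right a y x) (·-right b y z))

    ⊥-sym : ∀ x y → B x y ≡ 0F → B y x ≡ 0F
    ⊥-sym x y e = trans (skew y x) (trans (cong -F_ e) -‿zero)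

    countThrough : Vect n → ℕ
    countThrough y = sumL (allVecs n) (λ x → sumL (allVecs n) (λ z → ind (good? B (x , y , z))))

    perpCount : Vect n → ℕ
    perpCount y = sumL (allVecs n) (λ z → ind (B y z ≟ 0F))

    countThrough-zero : countThrough 0V ≡ 0
    countThrough-zero = sumL-0 (allVecs n) (λ x → sumL-0 (allVecs n) (λ z →
        ind-no (λ { (_ , _ , li) → not-indep x (indep3⇒indep2 x 0V z li) }) (good? B (x , 0V , z))))
      where
        not-indep : ∀ (x : Vect n) → ¬ LinIndep2 x 0V
        not-indep x i2 = 1≢0 (proj₂ (i2 0F 1F (trans (cong₂ _+V_ (·V-zeroˡ x) (·V-zeroʳ 1F)) (+V-identityˡ 0V))))

    firstOK? : ∀ (y x : Vect n) → Dec ((B y x ≡ 0F) × ¬ InSpan1 x y)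
    firstOK? y x = (B y x ≟ 0F) ×-dec ¬? (inSpan1? x y)

    thirdOK? : ∀ (y x z : Vect n) → Dec ((B y z ≡ 0F) × ¬ InSpan2 z x y)
    thirdOK? y x z = (B y z ≟ 0F) ×-dec ¬? (inSpan2? z x y)

    good-factorises : ∀ y → y ≢ 0V → ∀ x z → ind (good? B (x , y , z)) ≡ ind (firstOK? y x) * ind (thirdOK? y x z)
    good-factorises y y≢0 x z = trans
      (ind-cong (λ { (bxy , byz , li) → (⊥-sym x y bxy , indep2⇒∉span x y (indep3⇒indep2 x y z li))
                                       , (byz , indep3⇒∉span x y z li) })
                (λ { ((byx , x∉) , (byz , z∉)) → ⊥-sym y x byx , byz
                                               , indep2+∉span⇒indep3 x y z (∉span⇒indep2 x y y≢0 x∉) z∉ })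
                (good? B (x , y , z)) (firstOK? y x ×-dec thirdOK? y x z))
      (ind-× (firstOK? y x) (thirdOK? y x z) (firstOK? y x ×-dec thirdOK? y x z))

    -- Double counting: if every admissible x has exactly C vectors of y^⊥ in
    -- ⟨x, y⟩, and y^⊥ ∩ ⟨y⟩ has c₁ elements, then with D admissible x
    -- we get T(y) + D·C = D·h(y) and D + c₁ = h(y).
    countThrough-shape : ∀ y → y ≢ 0V → ∀ C c₁ →
       (∀ x → ind (firstOK? y x) ≡ 1 → sumL (allVecs n) (λ z → ind ((B y z ≟ 0F) ×-dec inSpan2? z x y)) ≡ C) →
       sumL (allVecs n) (λ x → ind ((B y x ≟ 0F) ×-dec inSpan1? x y)) ≡ c₁ →
       Σ ℕ (λ D → (countThrough y + D * C ≡ D * perpCount y) × (D + c₁ ≡ perpCount y))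
    countThrough-shape y y≢0 C c₁ hC hc₁ = D , through , first
      where
        open ≡-Reasoning
        D = sumL (allVecs n) (λ x → ind (firstOK? y x))
        thirds : Vect n → ℕ
        thirds x = sumL (allVecs n) (λ z → ind (thirdOK? y x z))
        split-z : ∀ x → sumL (allVecs n) (λ z → ind ((B y z ≟ 0F) ×-dec inSpan2? z x y)) + thirds x ≡ perpCount y
        split-z x = trans (sym (sumL-+ (allVecs n) _ _)) (sumL-cong (allVecs n) (λ z →
          ind-split (B y z ≟ 0F) (inSpan2? z x y) ((B y z ≟ 0F) ×-dec inSpan2? z x y) (thirdOK? y x z)))
        per-x : ∀ x → ind (firstOK? y x) * thirds x + ind (firstOK? y x) * C ≡ ind (firstOK? y x) * perpCount y
        per-x x with firstOK? y x
        ... | no _ = refl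
        ... | yes ok = begin
            1 * thirds x + 1 * C ≡⟨ cong₂ _+_ (NP.*-identityˡ (thirds x)) (NP.*-identityˡ C) ⟩
            thirds x + C         ≡⟨ NP.+-comm (thirds x) C ⟩
            C + thirds x         ≡⟨ cong (_+ thirds x) (sym (hC x (ind-yes ok (firstOK? y x)))) ⟩
            _                    ≡⟨ split-z x ⟩
            perpCount y          ≡⟨ sym (NP.*-identityˡ (perpCount y)) ⟩
            1 * perpCount y      ∎
        through : countThrough y + D * C ≡ D * perpCount y
        through = begin
          countThrough y + D * C
            ≡⟨ cong₂ _+_ (sumL-cong (allVecs n) (λ x → trans (sumL-cong (allVecs n) (good-factorises y y≢0 x))
                                                           (sumL-*ˡ (allVecs n) (ind (firstOK? y x)) _)))
                         (sym (sumL-*ʳ (allVecs n) C _)) ⟩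
          sumL (allVecs n) (λ x → ind (firstOK? y x) * thirds x) + sumL (allVecs n) (λ x → ind (firstOK? y x) * C)
            ≡⟨ sym (sumL-+ (allVecs n) _ _) ⟩
          sumL (allVecs n) (λ x → ind (firstOK? y x) * thirds x + ind (firstOK? y x) * C)
            ≡⟨ sumL-cong (allVecs n) per-x ⟩
          sumL (allVecs n) (λ x → ind (firstOK? y x) * perpCount y)
            ≡⟨ sumL-*ʳ (allVecs n) (perpCount y) _ ⟩
          D * perpCount y ∎
        first : D + c₁ ≡ perpCount y
        first = begin
          D + c₁                                                                    ≡⟨ NP.+-comm D c₁ ⟩
          c₁ + D                                                                    ≡⟨ cong (_+ D) (sym hc₁) ⟩
          sumL (allVecs n) (λ x → ind ((B y x ≟ 0F) ×-dec inSpan1? x y)) + D         ≡⟨ sym (sumL-+ (allVecs n) _ _) ⟩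
          sumL (allVecs n) (λ x → ind ((B y x ≟ 0F) ×-dec inSpan1? x y) + ind (firstOK? y x))
            ≡⟨ sumL-cong (allVecs n) (λ x → ind-split (B y x ≟ 0F) (inSpan1? x y) _ (firstOK? y x)) ⟩
          perpCount y                                                               ∎

    perp-span2 : ∀ y x z → B y x ≡ 0F → B y y ≡ 0F → InSpan2 z x y → B y z ≡ 0F
    perp-span2 y x z yx yy (a , b , e) = begin
        B y z                          ≡⟨ cong (B y) e ⟩
        B y ((a ·V x) +V (b ·V y))     ≡⟨ B-right-combination y a x b y ⟩
        (a *F B y x) +F (b *F B y y)   ≡⟨ cong₂ (λ u v → (a *F u) +F (b *F v)) yx yy ⟩
        (a *F 0F) +F (b *F 0F)         ≡⟨ cong₂ _+F_ (*-zeroʳ a) (*-zeroʳ b) ⟩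
        0F +F 0F                       ≡⟨ +-identityˡ 0F ⟩
        0F                             ∎
      where open ≡-Reasoning

    perp-span1 : ∀ y x → B y y ≡ 0F → InSpan1 x y → B y x ≡ 0F
    perp-span1 y x yy (a , e) = trans (cong (B y) e) (trans (·-right a y y) (trans (cong (a *F_) yy) (*-zeroʳ a)))

    countThrough-isotropic : ∀ y → y ≢ 0V → B y y ≡ 0F →
       Σ ℕ (λ D → (countThrough y + D * (p * p) ≡ D * perpCount y) × (D + p ≡ perpCount y))
    countThrough-isotropic y y≢0 yy = countThrough-shape y y≢0 (p * p) p plane line
      where
        plane : ∀ x → ind (firstOK? y x) ≡ 1 → sumL (allVecs n) (λ z → ind ((B y z ≟ 0F) ×-dec inSpan2? z x y)) ≡ p * p
        plane x ok with fromInd (firstOK? y x) ok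
        ... | (yx , x∉) = trans (sumL-cong (allVecs n) (λ z → ind-cong proj₂ (λ s → perp-span2 y x z yx yy s , s) _ (inSpan2? z x y)))
                               (|span2| x y (∉span⇒indep2 x y y≢0 x∉))
        line : sumL (allVecs n) (λ x → ind ((B y x ≟ 0F) ×-dec inSpan1? x y)) ≡ p
        line = trans (sumL-cong (allVecs n) (λ x → ind-cong proj₂ (λ s → perp-span1 y x yy s , s) _ (inSpan1? x y)))
                     (|span1| y y≢0)

    module Anisotropic (y : Vect n) (yy≢0 : B y y ≢ 0F) where

      y≢0 : y ≢ 0V
      y≢0 refl = yy≢0 (B-right-zero 0V)

      cancel-yy : ∀ b → b *F B y y ≡ 0F → b ≡ 0F
      cancel-yy b e with no-zero-divisors b (B y y) e
      ... | inj₁ b≡0 = b≡0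
      ... | inj₂ yy≡0 = ⊥-elim (yy≢0 yy≡0)

      perp∩span2⇒span1 : ∀ x z → B y x ≡ 0F → (B y z ≡ 0F) × InSpan2 z x y → InSpan1 z x
      perp∩span2⇒span1 x z yx (yz , (a , b , e)) =
          a , trans e (trans (cong (λ k → (a ·V x) +V (k ·V y)) b≡0)
                             (trans (cong ((a ·V x) +V_) (·V-zeroˡ y)) (+V-identityʳ _)))
        where
          b≡0 : b ≡ 0F
          b≡0 = cancel-yy b (begin
            b *F B y y                     ≡⟨ sym (+-identityˡ _) ⟩
            0F +F (b *F B y y)             ≡⟨ cong (_+F (b *F B y y)) (sym (trans (cong (a *F_) yx) (*-zeroʳ a))) ⟩
            (a *F B y x) +F (b *F B y y)   ≡⟨ sym (B-right-combination y a x b y) ⟩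
            B y ((a ·V x) +V (b ·V y))     ≡⟨ cong (B y) (sym e) ⟩
            B y z                          ≡⟨ yz ⟩
            0F                             ∎)
            where open ≡-Reasoning

      span1⇒perp∩span2 : ∀ x z → B y x ≡ 0F → InSpan1 z x → (B y z ≡ 0F) × InSpan2 z x y
      span1⇒perp∩span2 x z yx (a , e) =
          trans (cong (B y) e) (trans (·-right a y x) (trans (cong (a *F_) yx) (*-zeroʳ a)))
        , (a , 0F , trans e (sym (trans (cong ((a ·V x) +V_) (·V-zeroˡ y)) (+V-identityʳ _))))

      perp∩span1⇒zero : ∀ x → (B y x ≡ 0F) × InSpan1 x y → x ≡ 0V
      perp∩span1⇒zero x (yx , (a , e)) = trans e (trans (cong (_·V y) a≡0) (·V-zeroˡ y))
        where a≡0 : a ≡ 0F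
              a≡0 = cancel-yy a (trans (sym (·-right a y y)) (trans (cong (B y) (sym e)) yx))

      zero⇒perp∩span1 : ∀ x → x ≡ 0V → (B y x ≡ 0F) × InSpan1 x y
      zero⇒perp∩span1 x refl = B-right-zero y , (0F , sym (·V-zeroˡ y))

      countThrough-anisotropic :
         Σ ℕ (λ D → (countThrough y + D * p ≡ D * perpCount y) × (D + 1 ≡ perpCount y))
      countThrough-anisotropic = countThrough-shape y y≢0 p 1 plane line
        where
          plane : ∀ x → ind (firstOK? y x) ≡ 1 → sumL (allVecs n) (λ z → ind ((B y z ≟ 0F) ×-dec inSpan2? z x y)) ≡ p
          plane x ok with fromInd (firstOK? y x) ok
          ... | (yx , x∉) = trans (sumL-cong (allVecs n) (λ z → ind-cong (perp∩span2⇒span1 x z yx) (span1⇒perp∩span2 x z yx)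
                                                                         _ (inSpan1? z x)))
                                 (|span1| x (λ x≡0 → x∉ (0F , trans x≡0 (sym (·V-zeroˡ y)))))
          line : sumL (allVecs n) (λ x → ind ((B y x ≟ 0F) ×-dec inSpan1? x y)) ≡ 1
          line = trans (sumL-cong (allVecs n) (λ x → ind-cong (perp∩span1⇒zero x) (zero⇒perp∩span1 x) _ (x ≟V 0V)))
                       (enumV n 0V)

    perpCount-radical : ∀ y → (∀ z → B y z ≡ 0F) → perpCount y ≡ p ^ n
    perpCount-radical y rad = trans (sumL-cong (allVecs n) (λ z → ind-yes (rad z) (B y z ≟ 0F))) (|Vect| n)

    -- ... and p · h(y) = p^n otherwise: z ↦ z + t·u (with (y, u) = 1) maps y^⊥
    -- bijectively onto the level set {(y, ·) = t}, so all p level sets have size h(y).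
    perpCount-hyperplane : ∀ y w → B y w ≢ 0F → p * perpCount y ≡ p ^ n
    perpCount-hyperplane y w yw≢0 with inverse (B y w) yw≢0
    ... | c , c·yw = sym (begin
        p ^ n                                                   ≡⟨ sym (|Vect| n) ⟩
        sumL (allVecs n) (λ _ → 1)                              ≡⟨ sumL-cong (allVecs n) (λ z → sym (enumF (B y z))) ⟩
        sumL (allVecs n) (λ z → sumL (allFin p) (λ t → ind (t ≟ B y z)))
                                                                ≡⟨ sumL-swap (allVecs n) (allFin p) _ ⟩
        sumL (allFin p) (λ t → sumL (allVecs n) (λ z → ind (t ≟ B y z)))
                                                                ≡⟨ sumL-cong (allFin p) (λ t → sym (EnumV.reindex n
                                                                     (shift t) (shift (-F t)) (unshift t) (reshift t) _)) ⟩
        sumL (allFin p) (λ t → sumL (allVecs n) (λ z → ind (t ≟ B y (shift t z))))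
                                                                ≡⟨ sumL-cong (allFin p) (λ t → sumL-cong (allVecs n) (λ z →
                                                                     ind-cong (level⇒perp t z) (perp⇒level t z) _ (B y z ≟ 0F))) ⟩
        sumL (allFin p) (λ t → perpCount y)                     ≡⟨ sumL-const (allFin p) (perpCount y) ⟩
        sumL (allFin p) (λ t → 1) * perpCount y                 ≡⟨ cong (_* perpCount y) |F| ⟩
        p * perpCount y                                         ∎)
      where
        open ≡-Reasoning
        u : Vect n
        u = c ·V w
        shift : F → Vect n → Vect n
        shift t z = z +V (t ·V u)
        B-shift : ∀ t z → B y (shift t z) ≡ B y z +F t
        B-shift t z = trans (+-right y z (t ·V u)) (cong (B y z +F_)
          (trans (·-right t y u) (trans (cong (t *F_) (trans (·-right c y w) c·yw)) (*-identityʳ t))))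
        unshift : ∀ t z → shift (-F t) (shift t z) ≡ z
        unshift t z = trans (+V-assoc _ _ _) (trans (cong (z +V_) (·V-inverseʳ t u)) (+V-identityʳ z))
        reshift : ∀ t z → shift t (shift (-F t) z) ≡ z
        reshift t z = trans (+V-assoc _ _ _) (trans (cong (z +V_) (·V-inverseˡ t u)) (+V-identityʳ z))
        level⇒perp : ∀ t z → t ≡ B y (shift t z) → B y z ≡ 0F
        level⇒perp t z e = begin
            B y z                  ≡⟨ sym (+-identityʳ (B y z)) ⟩
            B y z +F 0F            ≡⟨ cong (B y z +F_) (sym (-‿inverseʳ t)) ⟩
            B y z +F (t +F (-F t)) ≡⟨ sym (+-assoc _ _ _) ⟩
            (B y z +F t) +F (-F t) ≡⟨ cong (_+F (-F t)) (trans (sym (B-shift t z)) (sym e)) ⟩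
            t +F (-F t)            ≡⟨ -‿inverseʳ t ⟩
            0F                     ∎
        perp⇒level : ∀ t z → B y z ≡ 0F → t ≡ B y (shift t z)
        perp⇒level t z e = sym (trans (B-shift t z) (trans (cong (_+F t) e) (+-identityˡ t)))

  -- Maps q with q(x + y) = q x + q y and q(c x) = c² q x; the diagonal
  -- a ↦ (a, a) of a skew form is one.  Such a map is determined by its values
  -- on the standard basis.
  record IsQuadratic {m : ℕ} (q : Vect m → F) : Set where
    field
      additive : ∀ x y → q (x +V y) ≡ q x +F q y
      scaling  : ∀ c x → q (c ·V x) ≡ (c *F c) *F q x

  split-head : ∀ {m} c (x : Vect m) → c ∷ x ≡ (c ·V unit Fin.zero) +V (0F ∷ x)
  split-head c x = sym (cong₂ _∷_ (trans (cong (_+F 0F) (*-identityʳ c)) (+-identityʳ c))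
                                  (trans (cong (_+V x) (·V-zeroʳ c)) (+V-identityˡ x)))

  quadratic-tail : ∀ {m} (q : Vect (suc m) → F) → IsQuadratic q → IsQuadratic (λ x → q (0F ∷ x))
  quadratic-tail q iq = record
    { additive = λ x y → trans (cong q (cong (_∷ (x +V y)) (sym (+-identityˡ 0F)))) (additive (0F ∷ x) (0F ∷ y))
    ; scaling  = λ c x → trans (cong q (cong (_∷ (c ·V x)) (sym (*-zeroʳ c)))) (scaling c (0F ∷ x)) }
    where open IsQuadratic iq

  quadratic-∷ : ∀ {m} (q : Vect (suc m) → F) → IsQuadratic q → ∀ c x →
                q (c ∷ x) ≡ ((c *F c) *F q (unit Fin.zero)) +F q (0F ∷ x)
  quadratic-∷ q iq c x =
    trans (cong q (split-head c x)) (trans (additive _ _) (cong (_+F q (0F ∷ x)) (scaling c _)))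
    where open IsQuadratic iq

  quadratic-vanishes : ∀ {m} (q : Vect m → F) → IsQuadratic q → (∀ i → q (unit i) ≡ 0F) → ∀ x → q x ≡ 0F
  quadratic-vanishes q iq h [] = begin
      q []                ≡⟨ cong q (sym (·V-zeroˡ [])) ⟩
      q (0F ·V [])        ≡⟨ IsQuadratic.scaling iq 0F [] ⟩
      (0F *F 0F) *F q []  ≡⟨ cong (_*F q []) (*-zeroˡ 0F) ⟩
      0F *F q []          ≡⟨ *-zeroˡ (q []) ⟩
      0F                  ∎
    where open ≡-Reasoning
  quadratic-vanishes q iq h (c ∷ x) = begin
      q (c ∷ x)                                      ≡⟨ quadratic-∷ q iq c x ⟩
      ((c *F c) *F q (unit Fin.zero)) +F q (0F ∷ x)  ≡⟨ cong₂ _+F_ (trans (cong ((c *F c) *F_) (h Fin.zero)) (*-zeroʳ (c *F c)))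
                                                          (quadratic-vanishes (λ x → q (0F ∷ x)) (quadratic-tail q iq)
                                                                              (λ i → h (Fin.suc i)) x) ⟩
      0F +F 0F                                       ≡⟨ +-identityˡ 0F ⟩
      0F                                             ∎
    where open ≡-Reasoning

  square-zero : ∀ c → c *F c ≡ 0F → c ≡ 0F
  square-zero c e with no-zero-divisors c c e
  ... | inj₁ c≡0 = c≡0
  ... | inj₂ c≡0 = c≡0

  module FirstSquare (m : ℕ) (q : Vect (suc m) → F) (iq : IsQuadratic q)
                     (q-e₀ : q (unit Fin.zero) ≡ 1F) (q-eᵢ : ∀ j → q (unit (Fin.suc j)) ≡ 0F) where

    q-∷ : ∀ c x → q (c ∷ x) ≡ c *F c
    q-∷ c x = begin
      q (c ∷ x)                                     ≡⟨ quadratic-∷ q iq c x ⟩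
      ((c *F c) *F q (unit Fin.zero)) +F q (0F ∷ x) ≡⟨ cong₂ _+F_ (cong ((c *F c) *F_) q-e₀)
                                                          (quadratic-vanishes (λ x → q (0F ∷ x)) (quadratic-tail q iq) q-eᵢ x) ⟩
      ((c *F c) *F 1F) +F 0F                        ≡⟨ +-identityʳ _ ⟩
      (c *F c) *F 1F                                ≡⟨ *-identityʳ _ ⟩
      c *F c                                        ∎
      where open ≡-Reasoning

    head-zero : ∀ c x → q (c ∷ x) ≡ 0F → c ≡ 0F
    head-zero c x e = square-zero c (trans (sym (q-∷ c x)) e)

    q-at-zero : ∀ x → q (0F ∷ x) ≡ 0F
    q-at-zero x = trans (q-∷ 0F x) (*-zeroˡ 0F)

    anisotropic-count : sumL (allVecs (suc m)) (λ a → ind (¬? (q a ≟ 0F)))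
                        ≡ sumL (allFin p) (λ c → ind (¬? (c ≟ 0F))) * p ^ m
    anisotropic-count = begin
      sumL (allVecs (suc m)) (λ a → ind (¬? (q a ≟ 0F)))
        ≡⟨ sumV-suc m _ ⟩
      sumL (allFin p) (λ c → sumL (allVecs m) (λ a → ind (¬? (q (c ∷ a) ≟ 0F))))
        ≡⟨ sumL-cong (allFin p) (λ c → sumL-cong (allVecs m) (λ a →
             ind-cong (λ q≢0 c≡0 → q≢0 (trans (cong (λ k → q (k ∷ a)) c≡0) (q-at-zero a)))
                      (λ c≢0 q≡0 → c≢0 (head-zero c a q≡0)) (¬? (q (c ∷ a) ≟ 0F)) (¬? (c ≟ 0F)))) ⟩
      sumL (allFin p) (λ c → sumL (allVecs m) (λ a → ind (¬? (c ≟ 0F))))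
        ≡⟨ sumL-cong (allFin p) (λ c → trans (sumV-const m _) (NP.*-comm (p ^ m) _)) ⟩
      sumL (allFin p) (λ c → ind (¬? (c ≟ 0F)) * p ^ m)
        ≡⟨ sumL-*ʳ (allFin p) (p ^ m) _ ⟩
      sumL (allFin p) (λ c → ind (¬? (c ≟ 0F))) * p ^ m ∎
      where open ≡-Reasoning

    -- #{a ≠ 0 : q a = 0} = p^m - 1: such a are 0 ∷ x with x ≠ 0.
    isotropic-count : sumL (allVecs (suc m)) (λ a → ind (¬? (a ≟V 0V) ×-dec (q a ≟ 0F))) + 1 ≡ p ^ m
    isotropic-count = trans (cong (_+ 1) first-zero) (nonzero-count m)
      where
        open ≡-Reasoning
        to : ∀ c x → (c ∷ x ≢ 0V) × (q (c ∷ x) ≡ 0F) → (c ≡ 0F) × (x ≢ 0V)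
        to c x (nz , qz) = c≡0 , λ x≡0 → nz (cong₂ _∷_ c≡0 x≡0)
          where c≡0 = head-zero c x qz
        from : ∀ c x → (c ≡ 0F) × (x ≢ 0V) → (c ∷ x ≢ 0V) × (q (c ∷ x) ≡ 0F)
        from c x (refl , x≢0) = (λ e → x≢0 (VecP.∷-injectiveʳ e)) , q-at-zero x
        first-zero : sumL (allVecs (suc m)) (λ a → ind (¬? (a ≟V 0V) ×-dec (q a ≟ 0F)))
                     ≡ sumL (allVecs m) (λ x → ind (¬? (x ≟V 0V)))
        first-zero = begin
          _ ≡⟨ sumV-suc m _ ⟩
          sumL (allFin p) (λ c → sumL (allVecs m) (λ x → ind (¬? ((c ∷ x) ≟V 0V) ×-dec (q (c ∷ x) ≟ 0F))))
            ≡⟨ sumL-cong (allFin p) (λ c → sumL-cong (allVecs m) (λ x →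
                 trans (ind-cong (to c x) (from c x) _ ((c ≟ 0F) ×-dec ¬? (x ≟V 0V)))
                       (ind-× (c ≟ 0F) (¬? (x ≟V 0V)) _))) ⟩
          sumL (allFin p) (λ c → sumL (allVecs m) (λ x → ind (c ≟ 0F) * ind (¬? (x ≟V 0V))))
            ≡⟨ sumL-cong (allFin p) (λ c → sumL-*ˡ (allVecs m) (ind (c ≟ 0F)) _) ⟩
          sumL (allFin p) (λ c → ind (c ≟ 0F) * sumL (allVecs m) (λ x → ind (¬? (x ≟V 0V))))
            ≡⟨ sumL-*ʳ (allFin p) _ _ ⟩
          sumL (allFin p) (λ c → ind (c ≟ 0F)) * sumL (allVecs m) (λ x → ind (¬? (x ≟V 0V)))
            ≡⟨ cong (_* sumL (allVecs m) (λ x → ind (¬? (x ≟V 0V)))) (enumF 0F) ⟩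
          1 * _
            ≡⟨ NP.*-identityˡ _ ⟩
          _ ∎

  0V-++ : ∀ d e → (0V {d}) ++ (0V {e}) ≡ 0V {d + e}
  0V-++ zero e = refl
  0V-++ (suc d) e = cong (0F ∷_) (0V-++ d e)

  ++-as-sum : ∀ d e (a : Vect d) (b : Vect e) → a ++ b ≡ inV e a +V inW d b
  ++-as-sum d e a b = sym (trans (VecP.zipWith-++ _+F_ a 0V 0V b) (cong₂ _++_ (+V-identityʳ a) (+V-identityˡ b)))

  inV-+ : ∀ {d} e (x y : Vect d) → inV e (x +V y) ≡ inV e x +V inV e y
  inV-+ e x y = sym (trans (VecP.zipWith-++ _+F_ x 0V y 0V) (cong ((x +V y) ++_) (+V-identityˡ 0V)))

  inV-· : ∀ {d} e c (x : Vect d) → inV e (c ·V x) ≡ c ·V inV e x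
  inV-· e c x = sym (trans (VecP.map-++ (c *F_) x 0V) (cong ((c ·V x) ++_) (·V-zeroʳ c)))

  cancel-p : ∀ m k → p * k ≡ p ^ m → m ≢ 0 → k ≡ p ^ (m ∸ 1)
  cancel-p zero k eq m≢0 = ⊥-elim (m≢0 refl)
  cancel-p (suc m) k eq m≢0 = NP.*-cancelˡ-≡ k (p ^ m) p eq

  module Decomposition (d e : ℕ) (B : Vect (d + e) → Vect (d + e) → F)
      (bil : IsBilinear B) (skew : IsSkewSymmetric B)
      (nondeg : ∀ (x : Vect d) → (∀ (x' : Vect d) → B (inV e x) (inV e x') ≡ 0F) → x ≡ 0V)
      (W-trivial : ∀ (y y' : Vect e) → B (inW d y) (inW d y') ≡ 0F)
      (V⊥W : ∀ (x : Vect d) (y : Vect e) → B (inV e x) (inW d y) ≡ 0F) where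
    open IsBilinear bil
    open SkewForm (d + e) B bil skew

    BV : Vect d → Vect d → F
    BV a a' = B (inV e a) (inV e a')

    Q : Vect d → F
    Q a = BV a a

    B-++ : ∀ a b a' b' → B (a ++ b) (a' ++ b') ≡ BV a a'
    B-++ a b a' b' = begin
      B (a ++ b) (a' ++ b')                       ≡⟨ cong₂ B (++-as-sum d e a b) (++-as-sum d e a' b') ⟩
      B (u +V w) (u' +V w')                       ≡⟨ +-left u w (u' +V w') ⟩
      B u (u' +V w') +F B w (u' +V w')            ≡⟨ cong₂ _+F_ (+-right u u' w') (+-right w u' w') ⟩
      (B u u' +F B u w') +F (B w u' +F B w w')    ≡⟨ cong₂ (λ s t → (B u u' +F s) +F t) (V⊥W a b')
                                                       (cong₂ _+F_ (⊥-sym u' w (V⊥W a' b)) (W-trivial b b')) ⟩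
      (B u u' +F 0F) +F (0F +F 0F)                ≡⟨ cong₂ _+F_ (+-identityʳ _) (+-identityˡ 0F) ⟩
      B u u' +F 0F                                ≡⟨ +-identityʳ _ ⟩
      BV a a'                                     ∎
      where
        open ≡-Reasoning
        u = inV e a ; w = inW d b ; u' = inV e a' ; w' = inW d b'

    BV-zeroˡ : ∀ a' → BV 0V a' ≡ 0F
    BV-zeroˡ a' = begin
      B (inV e 0V) (inV e a')          ≡⟨ cong (λ k → B (inV e k) (inV e a')) (sym (·V-zeroˡ 0V)) ⟩
      B (inV e (0F ·V 0V)) (inV e a')  ≡⟨ cong (λ k → B k (inV e a')) (inV-· e 0F 0V) ⟩
      B (0F ·V inV e 0V) (inV e a')    ≡⟨ ·-left 0F _ _ ⟩
      0F *F B (inV e 0V) (inV e a')    ≡⟨ *-zeroˡ _ ⟩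
      0F                               ∎
      where open ≡-Reasoning

    -- Q is quadratic: the cross terms (u, v) + (v, u) cancel by skew-symmetry.
    Q-quadratic : IsQuadratic Q
    Q-quadratic = record { additive = Q-+ ; scaling = Q-· }
      where
        open ≡-Reasoning
        Q-+ : ∀ x y → Q (x +V y) ≡ Q x +F Q y
        Q-+ x y = begin
          Q (x +V y)                                       ≡⟨ cong₂ B (inV-+ e x y) (inV-+ e x y) ⟩
          B (u +V v) (u +V v)                              ≡⟨ +-left u v (u +V v) ⟩
          B u (u +V v) +F B v (u +V v)                     ≡⟨ cong₂ _+F_ (+-right u u v) (+-right v u v) ⟩
          (B u u +F B u v) +F (B v u +F B v v)             ≡⟨ cong (λ k → (B u u +F B u v) +F (k +F B v v)) (skew v u) ⟩
          (B u u +F B u v) +F ((-F B u v) +F B v v)        ≡⟨ +-assoc _ _ _ ⟩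
          B u u +F (B u v +F ((-F B u v) +F B v v))        ≡⟨ cong (B u u +F_) (sym (+-assoc _ _ _)) ⟩
          B u u +F ((B u v +F (-F B u v)) +F B v v)        ≡⟨ cong (λ k → B u u +F (k +F B v v)) (-‿inverseʳ _) ⟩
          B u u +F (0F +F B v v)                           ≡⟨ cong (B u u +F_) (+-identityˡ _) ⟩
          Q x +F Q y                                       ∎
          where u = inV e x ; v = inV e y
        Q-· : ∀ c x → Q (c ·V x) ≡ (c *F c) *F Q x
        Q-· c x = begin
          Q (c ·V x)               ≡⟨ cong₂ B (inV-· e c x) (inV-· e c x) ⟩
          B (c ·V u) (c ·V u)      ≡⟨ ·-left c u (c ·V u) ⟩
          c *F B u (c ·V u)        ≡⟨ cong (c *F_) (·-right c u u) ⟩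
          c *F (c *F B u u)        ≡⟨ sym (*-assoc c c _) ⟩
          (c *F c) *F Q x          ∎
          where u = inV e x

    h : ℕ
    h = p ^ (d + e ∸ 1)

    τ-radical τ-isotropic τ-anisotropic : ℤ
    τ-radical     = (+ (p ^ (d + e)) -ℤ + p) *ℤ (+ (p ^ (d + e)) -ℤ + p ^ 2)
    τ-isotropic   = (+ h -ℤ + p) *ℤ (+ h -ℤ + p ^ 2)
    τ-anisotropic = (+ h -ℤ + 1) *ℤ (+ h -ℤ + p)

    countN-by-middle : countN B ≡ sumL (allVecs (d + e)) countThrough
    countN-by-middle = trans (length-filter (good? B) (allTriples (d + e)))
       (trans (sumL-cart xs (cartesianProduct xs xs) _)
       (trans (sumL-cong xs (λ x → sumL-cart xs xs _))
              (sumL-swap xs xs _)))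
      where xs = allVecs (d + e)

    perpCount-nonradical : ∀ y w → B y w ≢ 0F → perpCount y ≡ h
    perpCount-nonradical y w yw≢0 = cancel-p (d + e) (perpCount y) (perpCount-hyperplane y w yw≢0) n≢0
      where
        n≢0 : d + e ≢ 0
        n≢0 n≡0 = yw≢0 (trans (cong (B y) (only-zero n≡0 w)) (B-right-zero y))
          where only-zero : ∀ {m} → m ≡ 0 → (v : Vect m) → v ≡ 0V
                only-zero refl [] = refl

    p·p : p * p ≡ p ^ 2
    p·p = cong (p *_) (sym (NP.*-identityʳ p))

    T-radical : ∀ y → y ≢ 0V → (∀ z → B y z ≡ 0F) → + countThrough y ≡ τ-radical
    T-radical y y≢0 rad with countThrough-isotropic y y≢0 (rad y)
    ... | D , e₁ , e₂ = trans (product-count (countThrough y) D (p * p) p (perpCount y) e₁ e₂)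
           (cong₂ (λ u v → (+ u -ℤ + p) *ℤ (+ u -ℤ + v)) (perpCount-radical y rad) p·p)

    T-isotropic : ∀ y w → y ≢ 0V → B y w ≢ 0F → B y y ≡ 0F → + countThrough y ≡ τ-isotropic
    T-isotropic y w y≢0 yw≢0 yy with countThrough-isotropic y y≢0 yy
    ... | D , e₁ , e₂ = trans (product-count (countThrough y) D (p * p) p (perpCount y) e₁ e₂)
           (cong₂ (λ u v → (+ u -ℤ + p) *ℤ (+ u -ℤ + v)) (perpCount-nonradical y w yw≢0) p·p)

    T-anisotropic : ∀ y → B y y ≢ 0F → + countThrough y ≡ τ-anisotropic
    T-anisotropic y yy≢0 with Anisotropic.countThrough-anisotropic y yy≢0
    ... | D , e₁ , e₂ = trans (product-count (countThrough y) D p 1 (perpCount y) e₁ e₂)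
           (cong (λ u → (+ u -ℤ + 1) *ℤ (+ u -ℤ + p)) (perpCount-nonradical y y yy≢0))

    ++-nonzero : ∀ (a : Vect d) (b : Vect e) → (a ≢ 0V ⊎ b ≢ 0V) → a ++ b ≢ 0V
    ++-nonzero a b nz eq with VecP.++-injective a 0V (trans eq (sym (0V-++ d e)))
    ... | a≡0 , b≡0 with nz
    ...   | inj₁ a≢0 = a≢0 a≡0
    ...   | inj₂ b≢0 = b≢0 b≡0

    W-radical : ∀ b z → B (0V ++ b) z ≡ 0F
    W-radical b z with splitAt d z
    ... | a' , b' , refl = trans (B-++ 0V b a' b') (BV-zeroˡ a')

    partner : ∀ a → a ≢ 0V → Σ (Vect d) (λ a' → BV a a' ≢ 0F)
    partner a a≢0 with EnumV.∀-or-∃¬ d (λ a' → BV a a' ≟ 0F)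
    ... | inj₁ all-zero = ⊥-elim (a≢0 (nondeg a all-zero))
    ... | inj₂ witness = witness

    radical isotropic : Vect d → Vect e → ℕ
    radical a b = ind (a ≟V 0V) * ind (¬? (b ≟V 0V))
    isotropic a _ = ind (¬? (a ≟V 0V) ×-dec (Q a ≟ 0F))

    anisotropic : Vect d → ℕ
    anisotropic a = ind (¬? (Q a ≟ 0F))

    T-by-components : ∀ a b → + countThrough (a ++ b)
      ≡ + radical a b *ℤ τ-radical +ℤ + isotropic a b *ℤ τ-isotropic +ℤ + anisotropic a *ℤ τ-anisotropic
    T-by-components a b with a ≟V 0V | b ≟V 0V | Q a ≟ 0F
    ... | yes refl | _ | no Q≢0 = ⊥-elim (Q≢0 (BV-zeroˡ 0V))
    ... | yes refl | yes refl | yes _ =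
      trans (cong (λ v → + countThrough v) (0V-++ d e)) (trans (cong +_ countThrough-zero) (sym (select τ-radical τ-isotropic τ-anisotropic)))
      where select : ∀ (x y z : ℤ) → + 0 *ℤ x +ℤ + 0 *ℤ y +ℤ + 0 *ℤ z ≡ + 0
            select = solve-∀
    ... | yes refl | no b≢0 | yes _ =
      trans (T-radical (0V ++ b) (++-nonzero 0V b (inj₂ b≢0)) (W-radical b)) (sym (select τ-radical τ-isotropic τ-anisotropic))
      where select : ∀ (x y z : ℤ) → + 1 *ℤ x +ℤ + 0 *ℤ y +ℤ + 0 *ℤ z ≡ x
            select = solve-∀
    ... | no a≢0 | _ | yes Q≡0 with partner a a≢0
    ...   | a' , aa'≢0 = trans (T-isotropic (a ++ b) (a' ++ 0V) (++-nonzero a b (inj₁ a≢0))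
                                           (λ eq → aa'≢0 (trans (sym (B-++ a b a' 0V)) eq)) (trans (B-++ a b a b) Q≡0))
                               (sym (select τ-radical τ-isotropic τ-anisotropic))
      where select : ∀ (x y z : ℤ) → + 0 *ℤ x +ℤ + 1 *ℤ y +ℤ + 0 *ℤ z ≡ y
            select = solve-∀
    T-by-components a b | no a≢0 | _ | no Q≢0 =
      trans (T-anisotropic (a ++ b) (λ eq → Q≢0 (trans (sym (B-++ a b a b)) eq))) (sym (select τ-radical τ-isotropic τ-anisotropic))
      where select : ∀ (x y z : ℤ) → + 0 *ℤ x +ℤ + 0 *ℤ y +ℤ + 1 *ℤ z ≡ z
            select = solve-∀

    nonzeroW isotropicV anisotropicV : ℕ
    nonzeroW = sumL (allVecs e) (λ b → ind (¬? (b ≟V 0V)))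
    isotropicV = sumL (allVecs d) (λ a → isotropic a 0V)
    anisotropicV = sumL (allVecs d) anisotropic

    radical-multiplicity : sumL (allVecs d) (λ a → sumL (allVecs e) (radical a)) ≡ nonzeroW
    radical-multiplicity = begin
      sumL (allVecs d) (λ a → sumL (allVecs e) (radical a)) ≡⟨ sumL-cong (allVecs d) (λ a → sumL-*ˡ (allVecs e) (ind (a ≟V 0V)) _) ⟩
      sumL (allVecs d) (λ a → ind (a ≟V 0V) * nonzeroW)     ≡⟨ sumL-*ʳ (allVecs d) nonzeroW _ ⟩
      sumL (allVecs d) (λ a → ind (a ≟V 0V)) * nonzeroW     ≡⟨ cong (_* nonzeroW) (enumV d 0V) ⟩
      1 * nonzeroW                                          ≡⟨ NP.*-identityˡ nonzeroW ⟩
      nonzeroW                                              ∎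
      where open ≡-Reasoning

    constant-in-W : ∀ (r : Vect d → ℕ) → sumL (allVecs d) (λ a → sumL (allVecs e) (λ _ → r a)) ≡ p ^ e * sumL (allVecs d) r
    constant-in-W r = trans (sumL-cong (allVecs d) (λ a → sumV-const e (r a))) (sumL-*ˡ (allVecs d) (p ^ e) r)

    countN-decomposition : + countN B
      ≡ + nonzeroW *ℤ τ-radical +ℤ + (p ^ e * isotropicV) *ℤ τ-isotropic +ℤ + (p ^ e * anisotropicV) *ℤ τ-anisotropic
    countN-decomposition = begin
      + countN B
        ≡⟨ cong +_ (trans countN-by-middle (sumV-++ d e countThrough)) ⟩
      + sumL (allVecs d) (λ a → sumL (allVecs e) (λ b → countThrough (a ++ b)))
        ≡⟨ trans (sumZ-pos (allVecs d) _) (sumZ-cong (allVecs d) (λ a → sumZ-pos (allVecs e) _)) ⟩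
      sumZ (allVecs d) (λ a → sumZ (allVecs e) (λ b → + countThrough (a ++ b)))
        ≡⟨ sumZ-cong (allVecs d) (λ a → sumZ-cong (allVecs e) (T-by-components a)) ⟩
      sumZ (allVecs d) (λ a → sumZ (allVecs e) (λ b →
          + radical a b *ℤ τ-radical +ℤ + isotropic a b *ℤ τ-isotropic +ℤ + anisotropic a *ℤ τ-anisotropic))
        ≡⟨ sumZ-cong (allVecs d) (λ a → sumZ-linear3 (allVecs e) (radical a) (isotropic a) (λ _ → anisotropic a) _ _ _) ⟩
      sumZ (allVecs d) (λ a → + sumL (allVecs e) (radical a) *ℤ τ-radical +ℤ + sumL (allVecs e) (isotropic a) *ℤ τ-isotropic
                              +ℤ + sumL (allVecs e) (λ _ → anisotropic a) *ℤ τ-anisotropic)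
        ≡⟨ sumZ-linear3 (allVecs d) _ _ _ τ-radical τ-isotropic τ-anisotropic ⟩
      + sumL (allVecs d) (λ a → sumL (allVecs e) (radical a)) *ℤ τ-radical
        +ℤ + sumL (allVecs d) (λ a → sumL (allVecs e) (isotropic a)) *ℤ τ-isotropic
        +ℤ + sumL (allVecs d) (λ a → sumL (allVecs e) (λ _ → anisotropic a)) *ℤ τ-anisotropic
        ≡⟨ cong₂ _+ℤ_ (cong₂ _+ℤ_ (cong (λ u → + u *ℤ τ-radical) radical-multiplicity)
                                  (cong (λ u → + u *ℤ τ-isotropic) (constant-in-W (λ a → isotropic a 0V))))
                      (cong (λ u → + u *ℤ τ-anisotropic) (constant-in-W anisotropic)) ⟩
      + nonzeroW *ℤ τ-radical +ℤ + (p ^ e * isotropicV) *ℤ τ-isotropic +ℤ + (p ^ e * anisotropicV) *ℤ τ-anisotropic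
        ∎
      where open ≡-Reasoning

    nonzeroW-value : + nonzeroW ≡ + (p ^ e) -ℤ + 1
    nonzeroW-value = pos-from-sum nonzeroW 1 (p ^ e) (nonzero-count e)

    -- Case (1): Q vanishes on the basis, hence everywhere, so every a ≠ 0 is
    -- isotropic and no a is anisotropic.
    case1 : (∀ (i : Fin d) → Q (unit i) ≡ 0F) →
      + countN B ≡
        ((+ (p ^ d) -ℤ + 1) *ℤ + (p ^ e)
          *ℤ (+ (p ^ (d + e ∸ 1)) -ℤ + p) *ℤ (+ (p ^ (d + e ∸ 1)) -ℤ + (p ^ 2)))
        +ℤ ((+ (p ^ e) -ℤ + 1) *ℤ (+ (p ^ (d + e)) -ℤ + p) *ℤ (+ (p ^ (d + e)) -ℤ + (p ^ 2)))
    case1 Q-basis = begin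
      + countN B
        ≡⟨ countN-decomposition ⟩
      + nonzeroW *ℤ τ-radical +ℤ + (p ^ e * isotropicV) *ℤ τ-isotropic +ℤ + (p ^ e * anisotropicV) *ℤ τ-anisotropic
        ≡⟨ cong₂ _+ℤ_ (cong₂ _+ℤ_ (cong (_*ℤ τ-radical) nonzeroW-value) (cong (_*ℤ τ-isotropic) isotropic-part))
                      (cong (λ u → + u *ℤ τ-anisotropic) (trans (cong (p ^ e *_) no-anisotropic) (NP.*-zeroʳ (p ^ e)))) ⟩
      (+ (p ^ e) -ℤ + 1) *ℤ τ-radical +ℤ (+ (p ^ e) *ℤ (+ (p ^ d) -ℤ + 1)) *ℤ τ-isotropic +ℤ + 0 *ℤ τ-anisotropic
        ≡⟨ rearrange (+ (p ^ d)) (+ (p ^ e)) (+ h) (+ p) (+ (p ^ 2)) (+ (p ^ (d + e))) τ-anisotropic ⟩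
      _ ∎
      where
        open ≡-Reasoning
        Q≡0 : ∀ a → Q a ≡ 0F
        Q≡0 = quadratic-vanishes Q Q-quadratic Q-basis
        no-anisotropic : anisotropicV ≡ 0
        no-anisotropic = sumL-0 (allVecs d) (λ a → ind-no (λ Q≢0 → Q≢0 (Q≡0 a)) (¬? (Q a ≟ 0F)))
        all-isotropic : isotropicV + 1 ≡ p ^ d
        all-isotropic = trans (cong (_+ 1) (sumL-cong (allVecs d) (λ a → ind-cong proj₁ (λ a≢0 → a≢0 , Q≡0 a) _ (¬? (a ≟V 0V)))))
                              (nonzero-count d)
        isotropic-part : + (p ^ e * isotropicV) ≡ + (p ^ e) *ℤ (+ (p ^ d) -ℤ + 1)
        isotropic-part = trans (ZP.pos-* (p ^ e) isotropicV) (cong (+ (p ^ e) *ℤ_) (pos-from-sum isotropicV 1 (p ^ d) all-isotropic))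
        rearrange : ∀ (r s h q q² P τ : ℤ) →
          (s -ℤ + 1) *ℤ ((P -ℤ q) *ℤ (P -ℤ q²)) +ℤ (s *ℤ (r -ℤ + 1)) *ℤ ((h -ℤ q) *ℤ (h -ℤ q²)) +ℤ + 0 *ℤ τ
          ≡ ((r -ℤ + 1) *ℤ s *ℤ (h -ℤ q) *ℤ (h -ℤ q²)) +ℤ ((s -ℤ + 1) *ℤ (P -ℤ q) *ℤ (P -ℤ q²))
        rearrange = solve-∀

  module Case2 (d' e : ℕ) (B : Vect (suc d' + e) → Vect (suc d' + e) → F)
      (bil : IsBilinear B) (skew : IsSkewSymmetric B)
      (nondeg : ∀ (x : Vect (suc d')) → (∀ (x' : Vect (suc d')) → B (inV e x) (inV e x') ≡ 0F) → x ≡ 0V)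
      (W-trivial : ∀ (y y' : Vect e) → B (inW (suc d') y) (inW (suc d') y') ≡ 0F)
      (V⊥W : ∀ (x : Vect (suc d')) (y : Vect e) → B (inV e x) (inW (suc d') y) ≡ 0F)
      (Q-e₀ : B (inV e (unit Fin.zero)) (inV e (unit Fin.zero)) ≡ 1F)
      (Q-eᵢ : ∀ (j : Fin d') → B (inV e (unit (Fin.suc j))) (inV e (unit (Fin.suc j))) ≡ 0F) where
    open Decomposition (suc d') e B bil skew nondeg W-trivial V⊥W
    open FirstSquare d' Q Q-quadratic Q-e₀ Q-eᵢ

    -- (v₁, v₁) = 1 = -(v₁, v₁) by skew-symmetry.
    p≡2 : p ≡ 2
    p≡2 = char-two (trans (sym Q-e₀) (trans (skew _ _) (cong -F_ Q-e₀)))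

    nonzeroF : ℕ
    nonzeroF = sumL (allFin p) (λ c → ind (¬? (c ≟ 0F)))

    nonzeroF-value : + nonzeroF ≡ + p -ℤ + 1
    nonzeroF-value = pos-from-sum nonzeroF 1 p (trans (EnumF.count-others 0F) |F|)

    -- Multiplicities p^e - 1, p^e (p^(d-1) - 1) and p^e (p - 1) p^(d-1).
    count : + countN B ≡ case2-count d' e p
    count = trans countN-decomposition (cong₂ _+ℤ_ (cong₂ _+ℤ_
        (cong (_*ℤ τ-radical) nonzeroW-value)
        (cong (_*ℤ τ-isotropic) (trans (ZP.pos-* (p ^ e) isotropicV)
          (cong (+ (p ^ e) *ℤ_) (pos-from-sum isotropicV 1 (p ^ d') isotropic-count)))))
        (cong (_*ℤ τ-anisotropic) (trans (ZP.pos-* (p ^ e) anisotropicV) (cong (+ (p ^ e) *ℤ_)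
          (trans (cong +_ anisotropic-count) (trans (ZP.pos-* nonzeroF (p ^ d')) (cong (_*ℤ + (p ^ d')) nonzeroF-value)))))))

  -- Case (2) in the form of the lemma: the hypotheses force d = d' + 1, i₁ = v₁.
  case2 : (d e : ℕ) (B : Vect (d + e) → Vect (d + e) → F) → IsBilinear B → IsSkewSymmetric B →
    (∀ (x : Vect d) → (∀ (x' : Vect d) → B (inV e x) (inV e x') ≡ 0F) → x ≡ 0V) →
    (∀ (y y' : Vect e) → B (inW d y) (inW d y') ≡ 0F) →
    (∀ (x : Vect d) (y : Vect e) → B (inV e x) (inW d y) ≡ 0F) →
    (i₁ : Fin d) → toℕ i₁ ≡ 0 →
    B (inV e (unit i₁)) (inV e (unit i₁)) ≡ 1F →
    (∀ (i : Fin d) → i ≢ i₁ → B (inV e (unit i)) (inV e (unit i)) ≡ 0F) →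
    (p ≡ 2) ×
    (+ countN B ≡
      (+ (2 ^ (d + e ∸ 1)) -ℤ + 2)
        *ℤ (+ (2 ^ (2 * (d + e) ∸ 1)) +ℤ + 3 *ℤ + (2 ^ (d + 2 * e ∸ 1))
            -ℤ + 9 *ℤ + (2 ^ (d + e ∸ 1)) +ℤ + 4))
  case2 (suc d') e B bil skew nondeg W-trivial V⊥W Fin.zero _ Q-e₀ Q-others =
      p≡2 , trans count (trans (cong (case2-count d' e) p≡2) (case2-count-at-2 d' e))
    where open Case2 d' e B bil skew nondeg W-trivial V⊥W Q-e₀ (λ j → Q-others (Fin.suc j) (λ ()))

lemma5p2 : (p : ℕ) (pr : Prime p) (d e : ℕ) →
    let open Fp p pr in
    (B : Vect (d + e) → Vect (d + e) → F) →
    IsBilinear B →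
    IsSkewSymmetric B →
    (∀ (x : Vect d) → (∀ (x' : Vect d) → B (inV e x) (inV e x') ≡ 0F) → x ≡ 0V) →
    (∀ (y y' : Vect e) → B (inW d y) (inW d y') ≡ 0F) →
    (∀ (x : Vect d) (y : Vect e) → B (inV e x) (inW d y) ≡ 0F) →
    ((∀ (i : Fin d) → B (inV e (unit i)) (inV e (unit i)) ≡ 0F) →
      + countN B ≡
        ((+ (p ^ d) -ℤ + 1) *ℤ + (p ^ e)
          *ℤ (+ (p ^ (d + e ∸ 1)) -ℤ + p) *ℤ (+ (p ^ (d + e ∸ 1)) -ℤ + (p ^ 2)))
        +ℤ ((+ (p ^ e) -ℤ + 1) *ℤ (+ (p ^ (d + e)) -ℤ + p) *ℤ (+ (p ^ (d + e)) -ℤ + (p ^ 2))))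
    ×
    ((i₁ : Fin d) → toℕ i₁ ≡ 0 →
      B (inV e (unit i₁)) (inV e (unit i₁)) ≡ 1F →
      (∀ (i : Fin d) → i ≢ i₁ → B (inV e (unit i)) (inV e (unit i)) ≡ 0F) →
      (p ≡ 2) ×
      (+ countN B ≡
        (+ (2 ^ (d + e ∸ 1)) -ℤ + 2)
          *ℤ (+ (2 ^ (2 * (d + e) ∸ 1)) +ℤ + 3 *ℤ + (2 ^ (d + 2 * e ∸ 1))
              -ℤ + 9 *ℤ + (2 ^ (d + e ∸ 1)) +ℤ + 4)))
lemma5p2 p pr d e B bil skew nondeg W-trivial V⊥W =
    Decomposition.case1 d e B bil skew nondeg W-trivial V⊥W
  , case2 d e B bil skew nondeg W-trivial V⊥W
  where open PrimeField p pr
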